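{- Suppose $M$ is an infinite MA-presented $\mathcal L$-structure. Then every $\mathcal L$-formula is equivalent in $M$ to a formula in $\mathcal E^*$.
   Context: Languages have only relation and constant symbols. A relation $R\subseteq M^n$ is mutually algebraic if there is $K$ such that each $m\in M$ occurs in at most $K$ tuples of $R$; a formula is mutually algebraic if the relation it defines in $M$ is (every formula in one free variable is mutually algebraic). $M$ is MA-presented if every atomic $\mathcal L$-formula is mutually algebraic. $\mathcal E$ is the set of $\mathcal L$-formulas of the form $\exists\bar z\,\theta(\bar y,\bar z)$ where $\theta$ is a quantifier-free mutually algebraic $\mathcal L$-formula (allowing $\bar z$ empty). $\mathcal E^*$ is the set of $\mathcal L$-formulas equivalent (in $M$) to boolean combinations of formulas from $\mathcal E$, allowing adjunction of dummy free variables. -}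

module Defs where

open import Data.Nat using (ℕ; zero; suc; _+_)
open import Data.Fin using (Fin; zero; suc)
open import Data.Vec using (Vec; []; _∷_)
open import Data.Vec.Relation.Unary.Any using (Any)
open import Data.Product using (Σ; ∃; ∃-syntax; _×_; _,_)
open import Data.Sum using (_⊎_)
open import Data.Empty using (⊥)
open import Data.Unit using (⊤)
open import Relation.Nullary using (¬_)
open import Relation.Binary.PropositionalEquality using (_≡_; _≢_)
open import Function.Definitions using (Injective)
open import Function.Bundles using (_⇔_)

record Language : Set₁ where
  field
    Const : Set
    Rel   : Set
    arity : Rel → ℕ

module _ (L : Language) where
  open Language L

  data Term (n : ℕ) : Set where
    var   : Fin n → Term n
    const : Const → Term n

  -- first-order formulas with (at most) n free variables.
  -- ∃' and ∀' bind the variable 'zero' of Formula (suc n).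
  data Formula : ℕ → Set where
    ⊤'   : ∀ {n} → Formula n
    ⊥'   : ∀ {n} → Formula n
    _≐_  : ∀ {n} → Term n → Term n → Formula n
    rel  : ∀ {n} (R : Rel) → Vec (Term n) (arity R) → Formula n
    ¬'_  : ∀ {n} → Formula n → Formula n
    _∧'_ : ∀ {n} → Formula n → Formula n → Formula n
    _∨'_ : ∀ {n} → Formula n → Formula n → Formula n
    ∃'   : ∀ {n} → Formula (suc n) → Formula n
    ∀'   : ∀ {n} → Formula (suc n) → Formula n

  data Atomic : ∀ {n} → Formula n → Set where
    eq-atomic  : ∀ {n} (s t : Term n) → Atomic (s ≐ t)
    rel-atomic : ∀ {n} (R : Rel) (ts : Vec (Term n) (arity R)) → Atomic (rel R ts)

  data QF : ∀ {n} → Formula n → Set where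
    ⊤-qf  : ∀ {n} → QF {n} ⊤'
    ⊥-qf  : ∀ {n} → QF {n} ⊥'
    ≐-qf  : ∀ {n} (s t : Term n) → QF (s ≐ t)
    rel-qf : ∀ {n} (R : Rel) (ts : Vec (Term n) (arity R)) → QF (rel R ts)
    ¬-qf  : ∀ {n} {φ : Formula n} → QF φ → QF (¬' φ)
    ∧-qf  : ∀ {n} {φ ψ : Formula n} → QF φ → QF ψ → QF (φ ∧' ψ)
    ∨-qf  : ∀ {n} {φ ψ : Formula n} → QF φ → QF ψ → QF (φ ∨' ψ)

  OccursT : ∀ {n} → Fin n → Term n → Set
  OccursT i t = t ≡ var i

  Occurs : ∀ {n} → Fin n → Formula n → Set
  Occurs i ⊤'         = ⊥
  Occurs i ⊥'         = ⊥
  Occurs i (s ≐ t)    = OccursT i s ⊎ OccursT i t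
  Occurs i (rel R ts) = Any (OccursT i) ts
  Occurs i (¬' φ)     = Occurs i φ
  Occurs i (φ ∧' ψ)   = Occurs i φ ⊎ Occurs i ψ
  Occurs i (φ ∨' ψ)   = Occurs i φ ⊎ Occurs i ψ
  Occurs i (∃' φ)     = Occurs (suc i) φ
  Occurs i (∀' φ)     = Occurs (suc i) φ

  -- ∃ z̄ θ, where θ has k + n variables and the first k are bound
  ∃^ : ∀ (k : ℕ) {n} → Formula (k + n) → Formula n
  ∃^ zero    φ = φ
  ∃^ (suc k) φ = ∃^ k (∃' φ)

  record Structure : Set₁ where
    field
      Carrier : Set
      constI  : Const → Carrier
      relI    : (R : Rel) → Vec Carrier (arity R) → Set

  module _ (M : Structure) where
    open Structure M

    extend : ∀ {n} → Carrier → (Fin n → Carrier) → Fin (suc n) → Carrier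
    extend a v zero    = a
    extend a v (suc i) = v i

    evalT : ∀ {n} → (Fin n → Carrier) → Term n → Carrier
    evalT v (var i)   = v i
    evalT v (const c) = constI c

    evalTs : ∀ {n k} → (Fin n → Carrier) → Vec (Term n) k → Vec Carrier k
    evalTs v []       = []
    evalTs v (t ∷ ts) = evalT v t ∷ evalTs v ts

    Sat : ∀ {n} → Formula n → (Fin n → Carrier) → Set
    Sat ⊤'         v = ⊤
    Sat ⊥'         v = ⊥
    Sat (s ≐ t)    v = evalT v s ≡ evalT v t
    Sat (rel R ts) v = relI R (evalTs v ts)
    Sat (¬' φ)     v = ¬ Sat φ v
    Sat (φ ∧' ψ)   v = Sat φ v × Sat ψ v
    Sat (φ ∨' ψ)   v = Sat φ v ⊎ Sat ψ v
    Sat (∃' φ)     v = Σ Carrier λ a → Sat φ (extend a v)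
    Sat (∀' φ)     v = (a : Carrier) → Sat φ (extend a v)

    Infinite : Set
    Infinite = ¬ (Σ ℕ λ k → Σ (Fin k → Carrier) λ f → ∀ a → ∃[ i ] f i ≡ a)

    AtMost : ∀ {n} → ℕ → ((Fin n → Carrier) → Set) → Set
    AtMost {n} K Q = (f : Fin (suc K) → Fin n → Carrier) → (∀ i → Q (f i)) →
                     ∃[ i ] ∃[ j ] (i ≢ j × (∀ x → f i x ≡ f j x))

    MutAlgRel : ∀ {n} → ((Fin n → Carrier) → Set) → Set
    MutAlgRel R = ∃[ K ] ∀ (m : Carrier) → AtMost K (λ t → R t × ∃[ x ] t x ≡ m)

    MutAlg : ∀ {n} → Formula n → Set
    MutAlg φ = MutAlgRel (Sat φ)

    MAPresented : Set
    MAPresented = ∀ {n} (φ : Formula n) → Atomic φ → (∀ i → Occurs i φ) → MutAlg φ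

    InE : ∀ {n} → Formula n → Set
    InE {n} φ = ∃[ k ] Σ (Formula (k + n)) λ θ → QF θ × MutAlg θ × φ ≡ ∃^ k θ

    -- boolean combinations of 𝓔-formulas, each taken in an (injectively
    -- renamed) subtuple of the variables, i.e. allowing dummy variables
    data BoolE (n : ℕ) : Set where
      atomE : ∀ {m} (χ : Formula m) → InE χ → (ρ : Fin m → Fin n) →
              Injective _≡_ _≡_ ρ → BoolE n
      negE  : BoolE n → BoolE n
      andE  : BoolE n → BoolE n → BoolE n
      orE   : BoolE n → BoolE n → BoolE n

    SatB : ∀ {n} → BoolE n → (Fin n → Carrier) → Set
    SatB (atomE χ _ ρ _) v = Sat χ (λ i → v (ρ i))
    SatB (negE b)        v = ¬ SatB b v
    SatB (andE b c)      v = SatB b v × SatB c v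
    SatB (orE b c)       v = SatB b v ⊎ SatB c v

    InE* : ∀ {n} → Formula n → Set
    InE* {n} φ = Σ (BoolE n) λ b → ∀ (v : Fin n → Carrier) → Sat φ v ⇔ SatB b v

LEM : Set₁
LEM = (P : Set) → P ⊎ ¬ P

module Submission where

-- The proof is a quantifier elimination down to 𝓔*.  Atomic formulas are in
-- 𝓔 after discarding the variables they do not mention; 𝓔* is closed under
-- the boolean connectives by definition, and ∀ = ¬∃¬.  The work is to show
-- that ∃x b is in 𝓔* for a boolean combination b.  We put b in disjunctive
-- normal form over "pieces" (𝓔-formulas on injective subtuples of the
-- variables) and eliminate x from one clause ∃x (⋀ Pᵢ ∧ ⋀ ¬Nⱼ):
--   * literals not mentioning x are pulled out of the quantifier;
--   * the positive pieces mentioning x are conjoined into one piece P;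
--     conjunctions of mutually algebraic relations sharing a variable are
--     mutually algebraic (MA-conj), so P is again a piece;
--   * if P also mentions a parameter, then for every value of the
--     parameters only boundedly many x satisfy P (Linked-bounded), and
--     "at least s such x" is itself a piece (atLeastPiece); subtracting the
--     negative pieces one by one keeps these counts expressible
--     (Counted-minus), and ∃x is the count "at least 1";
--   * if P mentions x only, the set S of x satisfying P and the negative
--     pieces mentioning only x does not depend on the parameters: if S is
--     finite we count as before, and if S is infinite the clause is always
--     satisfiable since the remaining negative pieces each exclude boundedly
--     many x.
-- The development needs excluded middle (LEM) and only uses that M is
-- nonempty.

open import Defs
open import Data.Nat as ℕ using (ℕ; zero; suc; _+_; _*_; _≤_; z≤n)
import Data.Nat.Properties as ℕP
open import Data.Fin as F using (Fin; zero; suc; _↑ˡ_; _↑ʳ_; splitAt; punchIn; punchOut)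
import Data.Fin.Properties as FP
open import Data.Vec using (Vec; []; _∷_)
open import Data.Vec.Relation.Unary.Any as VAny using (Any; here; there)
open import Data.Product using (Σ; ∃-syntax; _×_; _,_; proj₁; proj₂)
open import Data.Sum using (_⊎_; inj₁; inj₂; [_,_]′)
open import Data.Empty using (⊥; ⊥-elim)
open import Data.Unit using (⊤; tt)
open import Data.Bool using (Bool; true; false)
open import Data.List as List using (List; []; _∷_; _++_)
open import Data.List.Relation.Unary.All as All using (All; []; _∷_)
open import Data.List.Membership.Propositional using (_∈_)
import Data.List.Membership.Propositional.Properties as MP
open import Relation.Nullary using (¬_; Dec; yes; no)
open import Relation.Nullary.Decidable using (_⊎-dec_; ¬?)
open import Relation.Binary.PropositionalEquality using (_≡_; _≢_; _≗_; refl; sym; trans; cong; cong₂; subst)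
open import Function.Definitions using (Injective)
open import Function.Bundles using (mk⇔)

-- Logical equivalence as a plain pair, so that both directions are projections.
infix 2 _↔_
_↔_ : Set → Set → Set
A ↔ B = (A → B) × (B → A)

Fin0-injective : ∀ {n} {f : Fin 0 → Fin n} {i j : Fin 0} → f i ≡ f j → i ≡ j
Fin0-injective {i = ()}

splitAt-injective : ∀ k {m} (i j : Fin (k + m)) → splitAt k i ≡ splitAt k j → i ≡ j
splitAt-injective k {m} i j e = trans (sym (FP.join-splitAt k m i)) (trans (cong (F.join k m) e) (FP.join-splitAt k m j))

record Enumeration (n : ℕ) (P : Fin n → Set) : Set where
  field
    size : ℕ
    index : Fin size → Fin n
    index-injective : ∀ {i j} → index i ≡ index j → i ≡ j
    index-onto : ∀ x → P x → Σ (Fin size) λ j → index j ≡ x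
    index-member : ∀ j → P (index j)

enumerate : ∀ {n} (P : Fin n → Set) → (∀ x → Dec (P x)) → Enumeration n P
enumerate {zero} P P? = record { size = 0 ; index = λ () ; index-injective = Fin0-injective ; index-onto = λ () ; index-member = λ () }
enumerate {suc n} P P? with enumerate (λ x → P (suc x)) (λ x → P? (suc x)) | P? zero
... | E | yes p0 = record { size = suc size ; index = ρ' ; index-injective = inj' ; index-onto = cov' ; index-member = mem' }
  where
    open Enumeration E
    ρ' : Fin (suc size) → Fin (suc n)
    ρ' zero = zero
    ρ' (suc j) = suc (index j)
    inj' : ∀ {i j} → ρ' i ≡ ρ' j → i ≡ j
    inj' {zero} {zero} e = refl
    inj' {suc i} {suc j} e = cong suc (index-injective (FP.suc-injective e))
    cov' : ∀ x → P x → Σ (Fin (suc size)) λ j → ρ' j ≡ x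
    cov' zero px = zero , refl
    cov' (suc x) px = let (j , e) = index-onto x px in suc j , cong suc e
    mem' : ∀ j → P (ρ' j)
    mem' zero = p0
    mem' (suc j) = index-member j
... | E | no np0 = record { size = size ; index = λ j → suc (index j)
                          ; index-injective = λ e → index-injective (FP.suc-injective e)
                          ; index-onto = cov' ; index-member = index-member }
  where
    open Enumeration E
    cov' : ∀ x → P x → Σ (Fin size) λ j → suc (index j) ≡ x
    cov' zero px = ⊥-elim (np0 px)
    cov' (suc x) px = let (j , e) = index-onto x px in j , cong suc e

module Classical (lem : LEM) where

  dne : ∀ {A : Set} → ¬ ¬ A → A
  dne {A} nn with lem A
  ... | inj₁ a = a
  ... | inj₂ na = ⊥-elim (nn na)

infinite-inhabited : LEM → (L : Language) (M : Structure L) → Infinite L M → Structure.Carrier M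
infinite-inhabited lem L M inf = dne (λ nc → inf (0 , (λ ()) , λ a → ⊥-elim (nc a)))
  where open Classical lem

module Semantics (L : Language) (M : Structure L) where
  open Structure M renaming (Carrier to C)

  Fm : ℕ → Set
  Fm = Formula L

  Asg : ℕ → Set
  Asg n = Fin n → C

  Holds : ∀ {n} → Fm n → Asg n → Set
  Holds = Sat L M

  ext : ∀ {n} → C → Asg n → Asg (suc n)
  ext = extend L M

  evalT-cong : ∀ {n} {v w : Asg n} → v ≗ w → (t : Term L n) → evalT L M v t ≡ evalT L M w t
  evalT-cong e (var i) = e i
  evalT-cong e (const c) = refl

  evalTs-cong : ∀ {n k} {v w : Asg n} → v ≗ w → (ts : Vec (Term L n) k) → evalTs L M v ts ≡ evalTs L M w ts
  evalTs-cong e [] = refl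
  evalTs-cong e (t ∷ ts) = cong₂ _∷_ (evalT-cong e t) (evalTs-cong e ts)

  ext-cong : ∀ {n} {v w : Asg n} a → v ≗ w → ext a v ≗ ext a w
  ext-cong a e zero = refl
  ext-cong a e (suc i) = e i

  ≗-sym : ∀ {n} {v w : Asg n} → v ≗ w → w ≗ v
  ≗-sym e i = sym (e i)

  Sat-cong : ∀ {n} (φ : Fm n) {v w : Asg n} → v ≗ w → Holds φ v → Holds φ w
  Sat-cong ⊤' e s = s
  Sat-cong ⊥' e s = s
  Sat-cong (s ≐ t) e p = trans (sym (evalT-cong e s)) (trans p (evalT-cong e t))
  Sat-cong (rel R ts) e p = subst (relI R) (evalTs-cong e ts) p
  Sat-cong (¬' φ) e p q = p (Sat-cong φ (≗-sym e) q)
  Sat-cong (φ ∧' ψ) e (p , q) = Sat-cong φ e p , Sat-cong ψ e q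
  Sat-cong (φ ∨' ψ) e (inj₁ p) = inj₁ (Sat-cong φ e p)
  Sat-cong (φ ∨' ψ) e (inj₂ q) = inj₂ (Sat-cong ψ e q)
  Sat-cong (∃' φ) e (a , p) = a , Sat-cong φ (ext-cong a e) p
  Sat-cong (∀' φ) e p a = Sat-cong φ (ext-cong a e) (p a)

  renT : ∀ {a b} → (Fin a → Fin b) → Term L a → Term L b
  renT σ (var i) = var (σ i)
  renT σ (const c) = const c

  renTs : ∀ {a b k} → (Fin a → Fin b) → Vec (Term L a) k → Vec (Term L b) k
  renTs σ [] = []
  renTs σ (t ∷ ts) = renT σ t ∷ renTs σ ts

  lift : ∀ {a b} → (Fin a → Fin b) → Fin (suc a) → Fin (suc b)
  lift σ zero = zero
  lift σ (suc i) = suc (σ i)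

  ren : ∀ {a b} → (Fin a → Fin b) → Fm a → Fm b
  ren σ ⊤' = ⊤'
  ren σ ⊥' = ⊥'
  ren σ (s ≐ t) = renT σ s ≐ renT σ t
  ren σ (rel R ts) = rel R (renTs σ ts)
  ren σ (¬' φ) = ¬' ren σ φ
  ren σ (φ ∧' ψ) = ren σ φ ∧' ren σ ψ
  ren σ (φ ∨' ψ) = ren σ φ ∨' ren σ ψ
  ren σ (∃' φ) = ∃' (ren (lift σ) φ)
  ren σ (∀' φ) = ∀' (ren (lift σ) φ)

  evalT-ren : ∀ {a b} (σ : Fin a → Fin b) (v : Asg b) t → evalT L M v (renT σ t) ≡ evalT L M (λ i → v (σ i)) t
  evalT-ren σ v (var i) = refl
  evalT-ren σ v (const c) = refl

  evalTs-ren : ∀ {a b k} (σ : Fin a → Fin b) (v : Asg b) (ts : Vec (Term L a) k) → evalTs L M v (renTs σ ts) ≡ evalTs L M (λ i → v (σ i)) ts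
  evalTs-ren σ v [] = refl
  evalTs-ren σ v (t ∷ ts) = cong₂ _∷_ (evalT-ren σ v t) (evalTs-ren σ v ts)

  ext-lift : ∀ {a b} (σ : Fin a → Fin b) (v : Asg b) x → (λ i → ext x v (lift σ i)) ≗ ext x (λ i → v (σ i))
  ext-lift σ v x zero = refl
  ext-lift σ v x (suc i) = refl

  Sat-ren : ∀ {a b} (σ : Fin a → Fin b) (φ : Fm a) (v : Asg b) → Holds (ren σ φ) v ↔ Holds φ (λ i → v (σ i))
  Sat-ren σ ⊤' v = (λ x → x) , (λ x → x)
  Sat-ren σ ⊥' v = (λ x → x) , (λ x → x)
  Sat-ren σ (s ≐ t) v = (λ p → trans (sym (evalT-ren σ v s)) (trans p (evalT-ren σ v t)))
                      , (λ p → trans (evalT-ren σ v s) (trans p (sym (evalT-ren σ v t))))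
  Sat-ren σ (rel R ts) v = subst (relI R) (evalTs-ren σ v ts) , subst (relI R) (sym (evalTs-ren σ v ts))
  Sat-ren σ (¬' φ) v = (λ p q → p (proj₂ (Sat-ren σ φ v) q)) , (λ p q → p (proj₁ (Sat-ren σ φ v) q))
  Sat-ren σ (φ ∧' ψ) v = (λ { (p , q) → proj₁ (Sat-ren σ φ v) p , proj₁ (Sat-ren σ ψ v) q })
                       , (λ { (p , q) → proj₂ (Sat-ren σ φ v) p , proj₂ (Sat-ren σ ψ v) q })
  Sat-ren σ (φ ∨' ψ) v = (λ { (inj₁ p) → inj₁ (proj₁ (Sat-ren σ φ v) p) ; (inj₂ q) → inj₂ (proj₁ (Sat-ren σ ψ v) q) })
                       , (λ { (inj₁ p) → inj₁ (proj₂ (Sat-ren σ φ v) p) ; (inj₂ q) → inj₂ (proj₂ (Sat-ren σ ψ v) q) })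
  Sat-ren σ (∃' φ) v = (λ { (x , p) → x , Sat-cong φ (ext-lift σ v x) (proj₁ (Sat-ren (lift σ) φ (ext x v)) p) })
                     , (λ { (x , p) → x , proj₂ (Sat-ren (lift σ) φ (ext x v)) (Sat-cong φ (≗-sym (ext-lift σ v x)) p) })
  Sat-ren σ (∀' φ) v = (λ p x → Sat-cong φ (ext-lift σ v x) (proj₁ (Sat-ren (lift σ) φ (ext x v)) (p x)))
                     , (λ p x → proj₂ (Sat-ren (lift σ) φ (ext x v)) (Sat-cong φ (≗-sym (ext-lift σ v x)) (p x)))

  QF-ren : ∀ {a b} (σ : Fin a → Fin b) {φ : Fm a} → QF L φ → QF L (ren σ φ)
  QF-ren σ ⊤-qf = ⊤-qf
  QF-ren σ ⊥-qf = ⊥-qf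
  QF-ren σ (≐-qf s t) = ≐-qf _ _
  QF-ren σ (rel-qf R ts) = rel-qf R _
  QF-ren σ (¬-qf q) = ¬-qf (QF-ren σ q)
  QF-ren σ (∧-qf q r) = ∧-qf (QF-ren σ q) (QF-ren σ r)
  QF-ren σ (∨-qf q r) = ∨-qf (QF-ren σ q) (QF-ren σ r)

  -- append w v assigns w to the first k variables and v to the rest; this is
  -- how ∃^ k binds its variables.
  append : ∀ {k n} → (Fin k → C) → Asg n → Asg (k + n)
  append {zero} w v = v
  append {suc k} w v zero = w zero
  append {suc k} w v (suc i) = append (λ j → w (suc j)) v i

  append-↑ˡ : ∀ {k n} (w : Fin k → C) (v : Asg n) i → append w v (i ↑ˡ n) ≡ w i
  append-↑ˡ {suc k} w v zero = refl
  append-↑ˡ {suc k} w v (suc i) = append-↑ˡ (λ j → w (suc j)) v i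

  append-↑ʳ : ∀ {k n} (w : Fin k → C) (v : Asg n) j → append w v (k ↑ʳ j) ≡ v j
  append-↑ʳ {zero} w v j = refl
  append-↑ʳ {suc k} w v j = append-↑ʳ (λ i → w (suc i)) v j

  append-splitAt : ∀ {k n} (w : Fin k → C) (v : Asg n) i → append w v i ≡ [ w , v ]′ (splitAt k i)
  append-splitAt {zero} w v i = refl
  append-splitAt {suc k} w v zero = refl
  append-splitAt {suc k} w v (suc i) with splitAt k i in eq
  ... | inj₁ b = trans (append-splitAt (λ j → w (suc j)) v i) (cong [ (λ j → w (suc j)) , v ]′ eq)
  ... | inj₂ b = trans (append-splitAt (λ j → w (suc j)) v i) (cong [ (λ j → w (suc j)) , v ]′ eq)

  append-uncons : ∀ {k n} (w : Fin (suc k) → C) (v : Asg n) → append w v ≗ ext (w zero) (append (λ j → w (suc j)) v)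
  append-uncons w v zero = refl
  append-uncons w v (suc i) = refl

  Sat-∃^ : ∀ k {n} (θ : Fm (k + n)) (v : Asg n) → Holds (∃^ L k θ) v ↔ Σ (Fin k → C) λ w → Holds θ (append w v)
  Sat-∃^ zero θ v = (λ p → (λ ()) , p) , proj₂
  Sat-∃^ (suc k) θ v =
    (λ p → let (w , (a , q)) = proj₁ (Sat-∃^ k (∃' θ) v) p
           in ext a w , Sat-cong θ (≗-sym (append-uncons (ext a w) v)) q)
    , (λ { (w , q) → proj₂ (Sat-∃^ k (∃' θ) v)
             ((λ j → w (suc j)) , w zero , Sat-cong θ (append-uncons w v) q) })

  Cover : ∀ {a} → ℕ → (Asg a → Set) → Set
  Cover {a} K Q = Σ (Fin K → Asg a) λ g → ∀ t → Q t → Σ (Fin K) λ i → g i ≗ t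

  Cover⇒AtMost : ∀ {a} K (Q : Asg a → Set) → Cover K Q → AtMost L M K Q
  Cover⇒AtMost K Q (g , cov) f allQ with FP.pigeonhole (ℕP.n<1+n K) (λ i → proj₁ (cov (f i) (allQ i)))
  ... | i , j , i<j , eq = i , j , FP.<⇒≢ i<j ,
        λ x → trans (sym (proj₂ (cov (f i) (allQ i)) x))
                (trans (cong (λ z → g z x) eq) (proj₂ (cov (f j) (allQ j)) x))

  MA-⊆ : ∀ {a} (R R' : Asg a → Set) → (∀ t → R t → R' t) → MutAlgRel L M R' → MutAlgRel L M R
  MA-⊆ R R' h (K , am) = K , λ m f allQ → am m f (λ i → h (f i) (proj₁ (allQ i)) , proj₂ (allQ i))

  MA-reindex : ∀ {a b} (π : Fin a → Fin b) (π⁻ : Fin b → Fin a) → (∀ y → π (π⁻ y) ≡ y) →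
           (R : Asg a → Set) → MutAlgRel L M R → MutAlgRel L M (λ t → R (λ i → t (π i)))
  MA-reindex π π⁻ sec R (K , am) = K , λ m f allQ →
    let (i , j , ne , e) = am m (λ i x → f i (π x))
                             (λ i → proj₁ (allQ i) ,
                                    (π⁻ (proj₁ (proj₂ (allQ i))) ,
                                     trans (cong (f i) (sec _)) (proj₂ (proj₂ (allQ i)))))
    in i , j , ne , λ x → trans (cong (f i) (sym (sec x))) (trans (e (π⁻ x)) (cong (f j) (sec x)))

  -- Every relation on the empty tuple is mutually algebraic (no tuple
  -- contains any element).
  MA-nullary : (R : Asg 0 → Set) → MutAlgRel L M R
  MA-nullary R = 0 , λ m f allQ → ⊥-elim (noo (proj₂ (allQ zero)))
    where noo : ∀ {c : C} {t : Asg 0} → ∃[ x ] (t x ≡ c) → ⊥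
          noo (() , _)

  -- A piece on n variables is an 𝓔-formula ∃^ nbound matrix in nfree
  -- variables, placed injectively via place on a subtuple of the n
  -- variables: the building blocks of the boolean combinations in 𝓔*.
  record Piece (n : ℕ) : Set where
    constructor mkPiece
    field
      nfree : ℕ
      place : Fin nfree → Fin n
      place-injective : ∀ {i j} → place i ≡ place j → i ≡ j
      nbound : ℕ
      matrix : Fm (nbound + nfree)
      matrix-qf : QF L matrix
      matrix-ma : MutAlg L M matrix
  open Piece public

  PSat : ∀ {n} → Piece n → Asg n → Set
  PSat p v = Holds (∃^ L (nbound p) (matrix p)) (λ i → v (place p i))

  PWitnessed : ∀ {n} → Piece n → Asg n → Set
  PWitnessed p v = Σ (Fin (nbound p) → C) λ w → Holds (matrix p) (append w (λ i → v (place p i)))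

  PSat↔ : ∀ {n} (p : Piece n) v → PSat p v ↔ PWitnessed p v
  PSat↔ p v = Sat-∃^ (nbound p) (matrix p) (λ i → v (place p i))

  PSat-cong : ∀ {n} (p : Piece n) {v v' : Asg n} → v ≗ v' → PSat p v → PSat p v'
  PSat-cong p e = Sat-cong (∃^ L (nbound p) (matrix p)) (λ i → e (place p i))

  Mentions : ∀ {n} → Piece n → Fin n → Set
  Mentions p x = Σ (Fin (nfree p)) λ j → place p j ≡ x

  Mentions? : ∀ {n} (p : Piece n) x → Dec (Mentions p x)
  Mentions? p x = FP.any? (λ j → place p j F.≟ x)

  sentencePiece : ∀ {n} (φ : Fm 0) → QF L φ → Piece n
  sentencePiece φ q = mkPiece 0 (λ ()) Fin0-injective 0 φ q (MA-nullary (Holds φ))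

  ⊤-piece ⊥-piece : ∀ {n} → Piece n
  ⊤-piece = sentencePiece ⊤' ⊤-qf
  ⊥-piece = sentencePiece ⊥' ⊥-qf

  renamePiece : ∀ {n n'} (σ : Fin n → Fin n') → (∀ {i j} → σ i ≡ σ j → i ≡ j) → Piece n → Piece n'
  renamePiece σ inj p = mkPiece (nfree p) (λ j → σ (place p j)) (λ e → place-injective p (inj e)) (nbound p) (matrix p) (matrix-qf p) (matrix-ma p)

  Shared : ∀ {n} → Piece n → Piece n → Set
  Shared p1 p2 = Σ (Fin (nfree p1)) λ j1 → Σ (Fin (nfree p2)) λ j2 → place p1 j1 ≡ place p2 j2

  module Strengthen {n} (p : Piece (suc n)) (np : ¬ Mentions p zero) where
    ρ' : Fin (nfree p) → Fin n
    ρ' j = punchOut {i = zero} {j = place p j} (λ e → np (j , sym e))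
    eρ' : ∀ j → suc (ρ' j) ≡ place p j
    eρ' j = FP.punchIn-punchOut {i = zero} {j = place p j} (λ e → np (j , sym e))
    piece : Piece n
    piece = mkPiece (nfree p) ρ' (λ e → place-injective p (trans (sym (eρ' _)) (trans (cong suc e) (eρ' _))))
                    (nbound p) (matrix p) (matrix-qf p) (matrix-ma p)
    sem : ∀ x v → PSat p (ext x v) ↔ PSat piece v
    sem x v = Sat-cong (∃^ L (nbound p) (matrix p)) (λ j → cong (ext x v) (sym (eρ' j)))
            , Sat-cong (∃^ L (nbound p) (matrix p)) (λ j → cong (ext x v) (eρ' j))

  -- Quantifying the variable zero inside a piece that mentions it at
  -- position j0: the witness for zero becomes an extra bound variable, and
  -- θ is reindexed along a bijection π, so the result is again a piece.
  module EliminateMentioned {n m' k : ℕ} (ρ : Fin (suc m') → Fin (suc n)) (inj : ∀ {i j} → ρ i ≡ ρ j → i ≡ j)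
              (θ : Fm (k + suc m')) (qf : QF L θ) (ma : MutAlg L M θ) (j0 : Fin (suc m')) (e0 : ρ j0 ≡ zero) where
    ne0 : ∀ j → zero ≢ ρ (punchIn j0 j)
    ne0 j e = FP.punchInᵢ≢i j0 j (inj (trans (sym e) (sym e0)))
    ρ' : Fin m' → Fin n
    ρ' j = punchOut (ne0 j)
    eρ' : ∀ j → suc (ρ' j) ≡ ρ (punchIn j0 j)
    eρ' j = FP.punchIn-punchOut (ne0 j)
    inj' : ∀ {i j} → ρ' i ≡ ρ' j → i ≡ j
    inj' e = FP.punchIn-injective j0 _ _ (inj (trans (sym (eρ' _)) (trans (cong suc e) (eρ' _))))

    -- π sends bound variables b to suc b, the free variable j0 to the new
    -- bound variable zero, and the other free variables j to their position
    -- among the remaining ones; π⁻ is a section of π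
    gπ : Fin k ⊎ Fin (suc m') → Fin (suc (k + m'))
    gπ (inj₁ b) = suc (b ↑ˡ m')
    gπ (inj₂ j) with j0 F.≟ j
    ... | yes _ = zero
    ... | no ne = suc (k ↑ʳ punchOut ne)
    π : Fin (k + suc m') → Fin (suc (k + m'))
    π i = gπ (splitAt k i)
    hπ : Fin k ⊎ Fin m' → Fin (k + suc m')
    hπ (inj₁ b) = b ↑ˡ suc m'
    hπ (inj₂ j) = k ↑ʳ punchIn j0 j
    π⁻ : Fin (suc (k + m')) → Fin (k + suc m')
    π⁻ zero = k ↑ʳ j0
    π⁻ (suc y) = hπ (splitAt k y)

    gπ-pi : ∀ j → gπ (inj₂ (punchIn j0 j)) ≡ suc (k ↑ʳ j)
    gπ-pi j with j0 F.≟ punchIn j0 j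
    ... | yes e = ⊥-elim (FP.punchInᵢ≢i j0 j (sym e))
    ... | no ne = cong (λ z → suc (k ↑ʳ z)) (trans (FP.punchOut-cong j0 refl) (FP.punchOut-punchIn j0))
    secS : ∀ s → π (hπ s) ≡ suc (F.join k m' s)
    secS (inj₁ b) rewrite FP.splitAt-↑ˡ k b (suc m') = refl
    secS (inj₂ j) rewrite FP.splitAt-↑ʳ k (suc m') (punchIn j0 j) = gπ-pi j
    sec : ∀ y → π (π⁻ y) ≡ y
    sec zero rewrite FP.splitAt-↑ʳ k (suc m') j0 with j0 F.≟ j0
    ... | yes _ = refl
    ... | no ne = ⊥-elim (ne refl)
    sec (suc y) = trans (secS (splitAt k y)) (cong suc (FP.join-splitAt k m' y))

    piece : Piece n
    piece = mkPiece m' ρ' inj' (suc k) (ren π θ) (QF-ren π qf)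
               (MA-⊆ (Holds (ren π θ)) _ (λ t s → proj₁ (Sat-ren π θ t) s) (MA-reindex π π⁻ sec (Holds θ) ma))

    -- under π, the witnesses w' for the new piece match the witnesses
    -- (tail w', with w' zero as value of the variable zero) for the old one
    module _ (v : Asg n) (w' : Fin (suc k) → C) where
      V : Asg (suc m')
      V j = ext (w' zero) v (ρ j)
      eqS : ∀ s → append w' (λ j → v (ρ' j)) (gπ s) ≡ [ (λ b → w' (suc b)) , V ]′ s
      eqS (inj₁ b) = append-↑ˡ (λ b → w' (suc b)) (λ j → v (ρ' j)) b
      eqS (inj₂ j) with j0 F.≟ j
      ... | yes refl = cong (ext (w' zero) v) (sym e0)
      ... | no ne = trans (append-↑ʳ (λ b → w' (suc b)) (λ j → v (ρ' j)) (punchOut ne))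
                      (cong (ext (w' zero) v) (trans (eρ' (punchOut ne)) (cong ρ (FP.punchIn-punchOut ne))))
      eqπ : ∀ i → append w' (λ j → v (ρ' j)) (π i) ≡ append (λ b → w' (suc b)) V i
      eqπ i = trans (eqS (splitAt k i)) (sym (append-splitAt (λ b → w' (suc b)) V i))

    P0 : Piece (suc n)
    P0 = mkPiece (suc m') ρ inj k θ qf ma

    sem : ∀ v → (Σ C λ x → PSat P0 (ext x v)) ↔ PSat piece v
    sem v = to , from
      where
        to : (Σ C λ x → PSat P0 (ext x v)) → PSat piece v
        to (x , s) = let (w , t) = proj₁ (PSat↔ P0 (ext x v)) s in
          proj₂ (PSat↔ piece v) (ext x w , proj₂ (Sat-ren π θ _) (Sat-cong θ (≗-sym (eqπ v (ext x w))) t))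
        from : PSat piece v → Σ C λ x → PSat P0 (ext x v)
        from s = let (w' , t) = proj₁ (PSat↔ piece v) s in
          w' zero , proj₂ (PSat↔ P0 (ext (w' zero) v)) ((λ b → w' (suc b)) , Sat-cong θ (eqπ v w') (proj₁ (Sat-ren π θ _) t))

  ∃-mentioned : ∀ {n} (p : Piece (suc n)) (j0 : Fin (nfree p)) → place p j0 ≡ zero → Piece n
  ∃-mentioned (mkPiece (suc m') ρ inj k θ qf ma) j0 e0 = EliminateMentioned.piece ρ inj θ qf ma j0 e0

  ∃-mentioned-sem : ∀ {n} (p : Piece (suc n)) (j0 : Fin (nfree p)) (e0 : place p j0 ≡ zero) v →
                (Σ C λ x → PSat p (ext x v)) ↔ PSat (∃-mentioned p j0 e0) v
  ∃-mentioned-sem (mkPiece (suc m') ρ inj k θ qf ma) j0 e0 v = EliminateMentioned.sem ρ inj θ qf ma j0 e0 v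

  -- Adding the constraint "variables ja and jb take distinct values" to a
  -- piece; a subrelation, hence still mutually algebraic.
  distinctPiece : ∀ {n} (p : Piece n) (ja jb : Fin (nfree p)) → Piece n
  distinctPiece p ja jb = mkPiece (nfree p) (place p) (place-injective p) (nbound p) θ
                            (∧-qf (matrix-qf p) (¬-qf (≐-qf _ _))) (MA-⊆ (Holds θ) (Holds (matrix p)) (λ t → proj₁) (matrix-ma p))
    where θ = matrix p ∧' (¬' (var (nbound p ↑ʳ ja) ≐ var (nbound p ↑ʳ jb)))

  distinctPiece-sem : ∀ {n} (p : Piece n) ja jb v → PSat (distinctPiece p ja jb) v ↔ (PSat p v × v (place p ja) ≢ v (place p jb))
  distinctPiece-sem p ja jb v = to , from
    where
      V = λ i → v (place p i)
      to : _
      to s = let (w , (t , ne)) = proj₁ (PSat↔ (distinctPiece p ja jb) v) s in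
             proj₂ (PSat↔ p v) (w , t) ,
             λ e → ne (trans (append-↑ʳ w V ja) (trans e (sym (append-↑ʳ w V jb))))
      from : _
      from (s , ne) = let (w , t) = proj₁ (PSat↔ p v) s in
             proj₂ (PSat↔ (distinctPiece p ja jb) v) (w , t , λ e → ne (trans (sym (append-↑ʳ w V ja)) (trans e (append-↑ʳ w V jb))))

  AtLeast : ℕ → (C → Set) → Set
  AtLeast s A = Σ (Fin s → C) λ xs → (∀ i j → xs i ≡ xs j → i ≡ j) × (∀ i → A (xs i))

  record Linked {n} (p : Piece (suc n)) : Set where
    constructor mkLinked
    field
      j0 : Fin (nfree p)
      e0 : place p j0 ≡ zero
      c : Fin n
      jc : Fin (nfree p)
      ec : place p jc ≡ suc c

  -- Linked pieces are uniformly bounded in the variable zero: by mutual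
  -- algebraicity around the value of the parameter c, for every assignment
  -- v at most K values x satisfy p(x, v).
  Linked-bounded : ∀ {n} (p : Piece (suc n)) → Linked p → Σ ℕ λ K → ∀ v → ¬ AtLeast (suc K) (λ x → PSat p (ext x v))
  Linked-bounded p (mkLinked j0 e0 c jc ec) with matrix-ma p
  ... | K , am = K , λ v → λ { (xs , dist , all) →
      let ws = λ i → proj₁ (proj₁ (PSat↔ p (ext (xs i) v)) (all i))
          V = λ i j → ext (xs i) v (place p j)
          ts = λ i → append (ws i) (V i)
          (i , j , ne , eq) = am (v c) ts (λ i → proj₂ (proj₁ (PSat↔ p (ext (xs i) v)) (all i)) ,
                                   (nbound p ↑ʳ jc , trans (append-↑ʳ (ws i) (V i) jc) (cong (ext (xs i) v) ec)))
          xe : xs i ≡ xs j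
          xe = trans (sym (cong (ext (xs i) v) e0)) (trans (sym (append-↑ʳ (ws i) (V i) j0))
                 (trans (eq (nbound p ↑ʳ j0)) (trans (append-↑ʳ (ws j) (V j) j0) (cong (ext (xs j) v) e0))))
      in ne (dist i j xe) }

  AtLeast-map : ∀ {s} {A B : C → Set} → (∀ x → A x → B x) → AtLeast s A → AtLeast s B
  AtLeast-map h (xs , d , a) = xs , d , λ i → h (xs i) (a i)

  AtLeast-mono : ∀ {m n} {A : C → Set} → m ≤ n → AtLeast n A → AtLeast m A
  AtLeast-mono le (xs , d , a) = (λ i → xs (F.inject≤ i le)) ,
    (λ i j e → FP.inject≤-injective le le i j (d _ _ e)) , (λ i → a _)

  AtLeast-cons : ∀ {s} {A : C → Set} x → A x → AtLeast s (λ y → A y × y ≢ x) → AtLeast (suc s) A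
  AtLeast-cons {A = A} x ax (xs , d , a) = ext x xs , d' , a'
    where
      d' : ∀ i j → ext x xs i ≡ ext x xs j → i ≡ j
      d' zero zero e = refl
      d' zero (suc j) e = ⊥-elim (proj₂ (a j) (sym e))
      d' (suc i) zero e = ⊥-elim (proj₂ (a i) e)
      d' (suc i) (suc j) e = cong suc (d i j e)
      a' : ∀ i → A (ext x xs i)
      a' zero = ax
      a' (suc i) = proj₁ (a i)

  AtLeast-++ : ∀ s b {A B : C → Set} → (∀ x → A x → B x → ⊥) → AtLeast s A → AtLeast b B → AtLeast (s + b) (λ x → A x ⊎ B x)
  AtLeast-++ s b {A} {B} disj (xs , dx , ax) (ys , dy , ay) = append xs ys , d , a
    where
      h : ∀ t → [ xs , ys ]′ t ≡ append xs ys (F.join s b t)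
      h t = trans (cong [ xs , ys ]′ (sym (FP.splitAt-join s b t))) (sym (append-splitAt xs ys (F.join s b t)))
      d0 : ∀ t u → [ xs , ys ]′ t ≡ [ xs , ys ]′ u → t ≡ u
      d0 (inj₁ i) (inj₁ j) e = cong inj₁ (dx i j e)
      d0 (inj₁ i) (inj₂ j) e = ⊥-elim (disj _ (ax i) (subst B (sym e) (ay j)))
      d0 (inj₂ i) (inj₁ j) e = ⊥-elim (disj _ (ax j) (subst B e (ay i)))
      d0 (inj₂ i) (inj₂ j) e = cong inj₂ (dy i j e)
      d : ∀ i j → append xs ys i ≡ append xs ys j → i ≡ j
      d i j e = splitAt-injective s i j (d0 _ _ (trans (sym (append-splitAt xs ys i)) (trans e (append-splitAt xs ys j))))
      a0 : ∀ t → A ([ xs , ys ]′ t) ⊎ B ([ xs , ys ]′ t)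
      a0 (inj₁ i) = inj₁ (ax i)
      a0 (inj₂ j) = inj₂ (ay j)
      a : ∀ i → A (append xs ys i) ⊎ B (append xs ys i)
      a i = subst (λ z → A z ⊎ B z) (sym (append-splitAt xs ys i)) (a0 (splitAt s i))

  BE : ℕ → Set
  BE n = BoolE L M n

  BHolds : ∀ {n} → BE n → Asg n → Set
  BHolds = SatB L M

  pieceB : ∀ {n} → Piece n → BE n
  pieceB p = atomE (∃^ L (nbound p) (matrix p)) (nbound p , matrix p , matrix-qf p , matrix-ma p , refl) (place p) (place-injective p)

  ⊤B ⊥B : ∀ {n} → BE n
  ⊤B = pieceB ⊤-piece
  ⊥B = pieceB ⊥-piece

  bigOr : ∀ {n} → ℕ → (ℕ → BE n) → BE n
  bigOr zero f = f 0
  bigOr (suc K) f = orE (bigOr K f) (f (suc K))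

  bigOr-sem : ∀ {n} K (f : ℕ → BE n) v → BHolds (bigOr K f) v ↔ Σ ℕ λ b → b ≤ K × BHolds (f b) v
  bigOr-sem zero f v = (λ t → 0 , z≤n , t) , λ { (zero , z≤n , t) → t }
  bigOr-sem (suc K) f v = to , from
    where
      to : BHolds (bigOr (suc K) f) v → Σ ℕ λ b → b ≤ suc K × BHolds (f b) v
      to (inj₁ t) = let (b , le , t') = proj₁ (bigOr-sem K f v) t in b , ℕP.m≤n⇒m≤1+n le , t'
      to (inj₂ t) = suc K , ℕP.≤-refl , t
      from : (Σ ℕ λ b → b ≤ suc K × BHolds (f b) v) → BHolds (bigOr (suc K) f) v
      from (b , le , t) with ℕP.m≤n⇒m<n∨m≡n le
      ... | inj₁ lt = inj₁ (proj₂ (bigOr-sem K f v) (b , ℕP.≤-pred lt , t))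
      ... | inj₂ refl = inj₂ t

  Definable : ∀ {n} → (Asg n → Set) → Set
  Definable {n} X = Σ (BE n) λ b → ∀ v → X v ↔ BHolds b v

  renameB : ∀ {m n} (σ : Fin m → Fin n) → (∀ {i j} → σ i ≡ σ j → i ≡ j) → BE m → BE n
  renameB σ inj (atomE χ e ρ i) = atomE χ e (λ j → σ (ρ j)) (λ e' → i (inj e'))
  renameB σ inj (negE b) = negE (renameB σ inj b)
  renameB σ inj (andE b c) = andE (renameB σ inj b) (renameB σ inj c)
  renameB σ inj (orE b c) = orE (renameB σ inj b) (renameB σ inj c)

  renameB-sem : ∀ {m n} (σ : Fin m → Fin n) (inj : ∀ {i j} → σ i ≡ σ j → i ≡ j) (b : BE m) v →
                BHolds (renameB σ inj b) v ↔ BHolds b (λ j → v (σ j))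
  renameB-sem σ inj (atomE χ e ρ i) v = (λ t → t) , (λ t → t)
  renameB-sem σ inj (negE b) v = (λ t u → t (proj₂ (renameB-sem σ inj b v) u)) , (λ t u → t (proj₁ (renameB-sem σ inj b v) u))
  renameB-sem σ inj (andE b c) v = (λ { (x , y) → proj₁ (renameB-sem σ inj b v) x , proj₁ (renameB-sem σ inj c v) y })
                            , (λ { (x , y) → proj₂ (renameB-sem σ inj b v) x , proj₂ (renameB-sem σ inj c v) y })
  renameB-sem σ inj (orE b c) v = (λ { (inj₁ x) → inj₁ (proj₁ (renameB-sem σ inj b v) x) ; (inj₂ y) → inj₂ (proj₁ (renameB-sem σ inj c v) y) })
                           , (λ { (inj₁ x) → inj₁ (proj₂ (renameB-sem σ inj b v) x) ; (inj₂ y) → inj₂ (proj₂ (renameB-sem σ inj c v) y) })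

  OccursT? : ∀ {n} (i : Fin n) (t : Term L n) → Dec (OccursT L i t)
  OccursT? i (var j) with j F.≟ i
  ... | yes refl = yes refl
  ... | no ne = no (λ { refl → ne refl })
  OccursT? i (const c) = no (λ ())

  Occurs? : ∀ {n} (i : Fin n) (φ : Fm n) → Atomic L φ → Dec (Occurs L i φ)
  Occurs? i (s ≐ t) _ = OccursT? i s ⊎-dec OccursT? i t
  Occurs? i (rel R ts) _ = VAny.any? (OccursT? i) ts

  dropVarT : ∀ {n} (i : Fin (suc n)) (t : Term L (suc n)) → ¬ OccursT L i t → Term L n
  dropVarT i (var j) nn = var (punchOut {i = i} {j = j} (λ e → nn (cong var (sym e))))
  dropVarT i (const c) nn = const c

  dropVarTs : ∀ {n k} (i : Fin (suc n)) (ts : Vec (Term L (suc n)) k) → ¬ Any (OccursT L i) ts → Vec (Term L n) k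
  dropVarTs i [] nn = []
  dropVarTs i (t ∷ ts) nn = dropVarT i t (λ o → nn (here o)) ∷ dropVarTs i ts (λ o → nn (there o))

  dropVarT-eval : ∀ {n} (i : Fin (suc n)) t nn (v : Asg (suc n)) → evalT L M (λ j → v (punchIn i j)) (dropVarT i t nn) ≡ evalT L M v t
  dropVarT-eval i (var j) nn v = cong v (FP.punchIn-punchOut _)
  dropVarT-eval i (const c) nn v = refl

  dropVarTs-eval : ∀ {n k} (i : Fin (suc n)) (ts : Vec _ k) nn (v : Asg (suc n)) → evalTs L M (λ j → v (punchIn i j)) (dropVarTs i ts nn) ≡ evalTs L M v ts
  dropVarTs-eval i [] nn v = refl
  dropVarTs-eval i (t ∷ ts) nn v = cong₂ _∷_ (dropVarT-eval i t _ v) (dropVarTs-eval i ts _ v)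

  dropVar : ∀ {n} (i : Fin (suc n)) (φ : Fm (suc n)) → Atomic L φ → ¬ Occurs L i φ →
         Σ (Fm n) λ φ' → Atomic L φ' × (∀ v → Holds φ' (λ j → v (punchIn i j)) ↔ Holds φ v)
  dropVar i (s ≐ t) _ nn = dropVarT i s (λ o → nn (inj₁ o)) ≐ dropVarT i t (λ o → nn (inj₂ o)) , eq-atomic _ _ ,
    λ v → (λ e → trans (sym (dropVarT-eval i s _ v)) (trans e (dropVarT-eval i t _ v)))
        , (λ e → trans (dropVarT-eval i s _ v) (trans e (sym (dropVarT-eval i t _ v))))
  dropVar i (rel R ts) _ nn = rel R (dropVarTs i ts nn) , rel-atomic _ _ ,
    λ v → subst (relI R) (dropVarTs-eval i ts nn v) , subst (relI R) (sym (dropVarTs-eval i ts nn v))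

  atomic⇒QF : ∀ {n} {φ : Fm n} → Atomic L φ → QF L φ
  atomic⇒QF (eq-atomic s t) = ≐-qf s t
  atomic⇒QF (rel-atomic R ts) = rel-qf R ts

module Conjunction (lem : LEM) (L : Language) (M : Structure L) (a₀ : Structure.Carrier M) where
  open Structure M renaming (Carrier to C)
  open Semantics L M

  -- Conversely to Cover⇒AtMost, a relation with the AtMost K bound is covered by K tuples
  -- (classically, by induction on K: remove one tuple t0 of Q and cover the
  -- rest by K - 1 tuples).
  AtMost⇒Cover : ∀ {a} K (Q : Asg a → Set) → AtMost L M K Q → Cover K Q
  AtMost⇒Cover zero Q am = (λ ()) , λ t q → ⊥-elim (noo (am (λ _ → t) (λ _ → q)))
    where
      noo : ∀ {B : Fin 1 → Fin 1 → Set} → ∃[ i ] ∃[ j ] (i ≢ j × B i j) → ⊥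
      noo (zero , zero , ne , _) = ne refl
  AtMost⇒Cover {a} (suc K) Q am with lem (Σ (Asg a) Q)
  ... | inj₂ nq = (λ _ _ → a₀) , λ t q → ⊥-elim (nq (t , q))
  ... | inj₁ (t0 , copiesPiece) =
      let (g , cov) = AtMost⇒Cover K Q' am' in
      prependTuple t0 g , cov'' g cov
    where
      prependTuple : ∀ {k} → Asg a → (Fin k → Asg a) → Fin (suc k) → Asg a
      prependTuple t f zero = t
      prependTuple t f (suc i) = f i
      Q' : Asg a → Set
      Q' t = Q t × ¬ (t ≗ t0)
      am' : AtMost L M K Q'
      am' f allQ with am (prependTuple t0 f) (λ { zero → copiesPiece ; (suc i) → proj₁ (allQ i) })
      ... | zero , zero , ne , e = ⊥-elim (ne refl)
      ... | zero , suc j , ne , e = ⊥-elim (proj₂ (allQ j) (λ x → sym (e x)))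
      ... | suc i , zero , ne , e = ⊥-elim (proj₂ (allQ i) e)
      ... | suc i , suc j , ne , e = i , j , (λ p → ne (cong suc p)) , e
      cov'' : (g : Fin K → Asg a) → (∀ t → Q' t → Σ (Fin K) λ i → g i ≗ t) →
              ∀ t → Q t → Σ (Fin (suc K)) λ i → prependTuple t0 g i ≗ t
      cov'' g cov t q with lem (t ≗ t0)
      ... | inj₁ e = zero , λ x → sym (e x)
      ... | inj₂ ne = let (i , e) = cov t (q , ne) in suc i , e

  -- A tuple through m
  -- is determined by one of K1 R1-tuples through m and then by one of K2
  -- R2-tuples through its c1-value (or symmetrically), giving a cover of size
  -- K1 K2 + K2 K1.
  module Glue {a1 a2 a : ℕ} (σ1 : Fin a1 → Fin a) (σ2 : Fin a2 → Fin a)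
      (surj : ∀ x → (Σ (Fin a1) λ y → σ1 y ≡ x) ⊎ (Σ (Fin a2) λ y → σ2 y ≡ x))
      (c1 : Fin a1) (c2 : Fin a2) (sh : σ1 c1 ≡ σ2 c2) where
    glue : Asg a1 → Asg a2 → Asg a
    glue t1 t2 x = [ (λ p → t1 (proj₁ p)) , (λ p → t2 (proj₁ p)) ]′ (surj x)

    glue-eq : ∀ t1 t2 (t : Asg a) → t1 ≗ (λ y → t (σ1 y)) → t2 ≗ (λ y → t (σ2 y)) → glue t1 t2 ≗ t
    glue-eq t1 t2 t e1 e2 x with surj x
    ... | inj₁ (y , e) = trans (e1 y) (cong t e)
    ... | inj₂ (y , e) = trans (e2 y) (cong t e)

    MA-conj : (R1 : Asg a1 → Set) (R2 : Asg a2 → Set) → MutAlgRel L M R1 → MutAlgRel L M R2 →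
      MutAlgRel L M (λ t → R1 (λ y → t (σ1 y)) × R2 (λ y → t (σ2 y)))
    MA-conj R1 R2 (K1 , am1) (K2 , am2) = K1 * K2 + K2 * K1 , λ m → Cover⇒AtMost _ _ (G m , covG m)
      where
        Q1 : C → Asg a1 → Set
        Q1 m t = R1 t × ∃[ x ] t x ≡ m
        Q2 : C → Asg a2 → Set
        Q2 m t = R2 t × ∃[ x ] t x ≡ m
        cv1 : ∀ m → Cover K1 (Q1 m)
        cv1 m = AtMost⇒Cover K1 (Q1 m) (am1 m)
        cv2 : ∀ m → Cover K2 (Q2 m)
        cv2 m = AtMost⇒Cover K2 (Q2 m) (am2 m)
        -- A m i j: the i-th R1-tuple through m glued to the j-th R2-tuple
        -- through its value at c1; B m j i symmetrically; G lists all of them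
        A : C → Fin K1 → Fin K2 → Asg a
        A m i j = glue (proj₁ (cv1 m) i) (proj₁ (cv2 (proj₁ (cv1 m) i c1)) j)
        B : C → Fin K2 → Fin K1 → Asg a
        B m j i = glue (proj₁ (cv1 (proj₁ (cv2 m) j c2)) i) (proj₁ (cv2 m) j)
        G : C → Fin (K1 * K2 + K2 * K1) → Asg a
        G m z = [ (λ c → A m (proj₁ (F.remQuot {K1} K2 c)) (proj₂ (F.remQuot {K1} K2 c)))
                , (λ c → B m (proj₁ (F.remQuot {K2} K1 c)) (proj₂ (F.remQuot {K2} K1 c))) ]′ (splitAt (K1 * K2) z)
        GA : ∀ m i j → G m (F.combine i j ↑ˡ (K2 * K1)) ≡ A m i j
        GA m i j rewrite FP.splitAt-↑ˡ (K1 * K2) (F.combine i j) (K2 * K1) = cong (λ p → A m (proj₁ p) (proj₂ p)) (FP.remQuot-combine {K1} {K2} i j)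
        GB : ∀ m j i → G m ((K1 * K2) ↑ʳ F.combine j i) ≡ B m j i
        GB m j i rewrite FP.splitAt-↑ʳ (K1 * K2) (K2 * K1) (F.combine j i) = cong (λ p → B m (proj₁ p) (proj₂ p)) (FP.remQuot-combine {K2} {K1} j i)
        -- G m covers the conjunction through m, according to whether m is
        -- attained in an R1- or an R2-coordinate
        covG : ∀ m t → (R1 (λ y → t (σ1 y)) × R2 (λ y → t (σ2 y))) × (∃[ x ] t x ≡ m) → Σ _ λ z → G m z ≗ t
        covG m t ((r1 , r2) , x , ex) with surj x
        ... | inj₁ (y , e) =
           let (i , ei) = proj₂ (cv1 m) (λ y → t (σ1 y)) (r1 , y , trans (cong t e) ex)
               m' = proj₁ (cv1 m) i c1
               (j , ej) = proj₂ (cv2 m') (λ y → t (σ2 y)) (r2 , c2 , trans (cong t (sym sh)) (sym (ei c1)))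
           in _ , λ z → trans (cong (λ f → f z) (GA m i j)) (glue-eq _ _ t ei ej z)
        ... | inj₂ (y , e) =
           let (j , ej) = proj₂ (cv2 m) (λ y → t (σ2 y)) (r2 , y , trans (cong t e) ex)
               m' = proj₁ (cv2 m) j c2
               (i , ei) = proj₂ (cv1 m') (λ y → t (σ1 y)) (r1 , c1 , trans (cong t sh) (sym (ej c2)))
           in _ , λ z → trans (cong (λ f → f z) (GB m j i)) (glue-eq _ _ t ei ej z)

  module ConjPiece {n} (p1 p2 : Piece n) (shr : Shared p1 p2) where
    -- the free variables of the conjunction are indexed by U, those of p1
    -- and p2 embed via σ1, σ2; bound variables are those of p1 then p2, and
    -- the matrices are renamed along τ1, τ2 accordingly
    m1 = nfree p1
    m2 = nfree p2
    k1 = nbound p1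
    k2 = nbound p2
    ρ1 = place p1
    ρ2 = place p2
    U : Enumeration n (λ x → Mentions p1 x ⊎ Mentions p2 x)
    U = enumerate _ (λ x → Mentions? p1 x ⊎-dec Mentions? p2 x)
    open Enumeration U
    σ1 : Fin m1 → Fin size
    σ1 j = proj₁ (index-onto (ρ1 j) (inj₁ (j , refl)))
    σ2 : Fin m2 → Fin size
    σ2 j = proj₁ (index-onto (ρ2 j) (inj₂ (j , refl)))
    eσ1 : ∀ j → index (σ1 j) ≡ ρ1 j
    eσ1 j = proj₂ (index-onto (ρ1 j) (inj₁ (j , refl)))
    eσ2 : ∀ j → index (σ2 j) ≡ ρ2 j
    eσ2 j = proj₂ (index-onto (ρ2 j) (inj₂ (j , refl)))
    K = k1 + k2
    f1 : Fin k1 ⊎ Fin m1 → Fin (K + size)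
    f1 = [ (λ b → (b ↑ˡ k2) ↑ˡ size) , (λ j → K ↑ʳ σ1 j) ]′
    f2 : Fin k2 ⊎ Fin m2 → Fin (K + size)
    f2 = [ (λ b → (k1 ↑ʳ b) ↑ˡ size) , (λ j → K ↑ʳ σ2 j) ]′
    τ1 : Fin (k1 + m1) → Fin (K + size)
    τ1 i = f1 (splitAt k1 i)
    τ2 : Fin (k2 + m2) → Fin (K + size)
    τ2 i = f2 (splitAt k2 i)
    θ : Fm (K + size)
    θ = ren τ1 (matrix p1) ∧' ren τ2 (matrix p2)

    τ1ˡ : ∀ b → τ1 (b ↑ˡ m1) ≡ (b ↑ˡ k2) ↑ˡ size
    τ1ˡ b rewrite FP.splitAt-↑ˡ k1 b m1 = refl
    τ1ʳ : ∀ j → τ1 (k1 ↑ʳ j) ≡ K ↑ʳ σ1 j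
    τ1ʳ j rewrite FP.splitAt-↑ʳ k1 m1 j = refl
    τ2ˡ : ∀ b → τ2 (b ↑ˡ m2) ≡ (k1 ↑ʳ b) ↑ˡ size
    τ2ˡ b rewrite FP.splitAt-↑ˡ k2 b m2 = refl
    τ2ʳ : ∀ j → τ2 (k2 ↑ʳ j) ≡ K ↑ʳ σ2 j
    τ2ʳ j rewrite FP.splitAt-↑ʳ k2 m2 j = refl

    surj : ∀ x → (Σ (Fin (k1 + m1)) λ y → τ1 y ≡ x) ⊎ (Σ (Fin (k2 + m2)) λ y → τ2 y ≡ x)
    surj x with splitAt K x in eq
    ... | inj₁ y with splitAt k1 y in eq2
    ...   | inj₁ b = inj₁ (b ↑ˡ m1 , trans (τ1ˡ b) (trans (cong (_↑ˡ size) (FP.splitAt⁻¹-↑ˡ eq2)) (FP.splitAt⁻¹-↑ˡ eq)))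
    ...   | inj₂ b = inj₂ (b ↑ˡ m2 , trans (τ2ˡ b) (trans (cong (_↑ˡ size) (FP.splitAt⁻¹-↑ʳ eq2)) (FP.splitAt⁻¹-↑ˡ eq)))
    surj x | inj₂ u with index-member u
    ... | inj₁ (j , e) = inj₁ (k1 ↑ʳ j , trans (τ1ʳ j) (trans (cong (K ↑ʳ_) (index-injective (trans (eσ1 j) e))) (FP.splitAt⁻¹-↑ʳ eq)))
    ... | inj₂ (j , e) = inj₂ (k2 ↑ʳ j , trans (τ2ʳ j) (trans (cong (K ↑ʳ_) (index-injective (trans (eσ2 j) e))) (FP.splitAt⁻¹-↑ʳ eq)))

    j1 = proj₁ shr
    j2 = proj₁ (proj₂ shr)
    sh : τ1 (k1 ↑ʳ j1) ≡ τ2 (k2 ↑ʳ j2)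
    sh = trans (τ1ʳ j1) (trans (cong (K ↑ʳ_) (index-injective (trans (eσ1 j1) (trans (proj₂ (proj₂ shr)) (sym (eσ2 j2)))))) (sym (τ2ʳ j2)))

    ma : MutAlg L M θ
    ma = MA-⊆ (Holds θ) _ (λ t s → proj₁ (Sat-ren τ1 (matrix p1) t) (proj₁ s) , proj₁ (Sat-ren τ2 (matrix p2) t) (proj₂ s))
           (Glue.MA-conj τ1 τ2 surj (k1 ↑ʳ j1) (k2 ↑ʳ j2) sh (Holds (matrix p1)) (Holds (matrix p2)) (matrix-ma p1) (matrix-ma p2))

    piece : Piece n
    piece = mkPiece size index index-injective K θ (∧-qf (QF-ren τ1 (matrix-qf p1)) (QF-ren τ2 (matrix-qf p2))) ma

    mentions₁ : ∀ {x} → Mentions p1 x → Mentions piece x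
    mentions₁ (j , e) = σ1 j , trans (eσ1 j) e
    mentions₂ : ∀ {x} → Mentions p2 x → Mentions piece x
    mentions₂ (j , e) = σ2 j , trans (eσ2 j) e

    module _ (v : Asg n) where
      Uv : Asg size
      Uv i = v (index i)
      app1 : (w : Fin K → C) (w1 : Fin k1 → C) → (∀ b → w (b ↑ˡ k2) ≡ w1 b) →
             ∀ i → append w Uv (τ1 i) ≡ append w1 (λ j → v (ρ1 j)) i
      app1 w w1 hw i = trans (h (splitAt k1 i)) (sym (append-splitAt w1 (λ j → v (ρ1 j)) i))
        where
          h : ∀ s → append w Uv (f1 s) ≡ [ w1 , (λ j → v (ρ1 j)) ]′ s
          h (inj₁ b) = trans (append-↑ˡ w Uv (b ↑ˡ k2)) (hw b)
          h (inj₂ j) = trans (append-↑ʳ w Uv (σ1 j)) (cong v (eσ1 j))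
      app2 : (w : Fin K → C) (w2 : Fin k2 → C) → (∀ b → w (k1 ↑ʳ b) ≡ w2 b) →
             ∀ i → append w Uv (τ2 i) ≡ append w2 (λ j → v (ρ2 j)) i
      app2 w w2 hw i = trans (h (splitAt k2 i)) (sym (append-splitAt w2 (λ j → v (ρ2 j)) i))
        where
          h : ∀ s → append w Uv (f2 s) ≡ [ w2 , (λ j → v (ρ2 j)) ]′ s
          h (inj₁ b) = trans (append-↑ˡ w Uv (k1 ↑ʳ b)) (hw b)
          h (inj₂ j) = trans (append-↑ʳ w Uv (σ2 j)) (cong v (eσ2 j))

      sem : PSat piece v ↔ (PSat p1 v × PSat p2 v)
      sem = to , from
        where
          to : PSat piece v → PSat p1 v × PSat p2 v
          to s = let (w , (s1 , s2)) = proj₁ (PSat↔ piece v) s in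
                 proj₂ (PSat↔ p1 v) ((λ b → w (b ↑ˡ k2)) ,
                   Sat-cong (matrix p1) (app1 w _ (λ b → refl)) (proj₁ (Sat-ren τ1 (matrix p1) _) s1)) ,
                 proj₂ (PSat↔ p2 v) ((λ b → w (k1 ↑ʳ b)) ,
                   Sat-cong (matrix p2) (app2 w _ (λ b → refl)) (proj₁ (Sat-ren τ2 (matrix p2) _) s2))
          from : PSat p1 v × PSat p2 v → PSat piece v
          from (s1 , s2) =
            let (w1 , t1) = proj₁ (PSat↔ p1 v) s1
                (w2 , t2) = proj₁ (PSat↔ p2 v) s2
                w = append w1 w2
            in proj₂ (PSat↔ piece v) (w ,
                 proj₂ (Sat-ren τ1 (matrix p1) _) (Sat-cong (matrix p1) (≗-sym (app1 w w1 (append-↑ˡ w1 w2))) t1) ,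
                 proj₂ (Sat-ren τ2 (matrix p2) _) (Sat-cong (matrix p2) (≗-sym (app2 w w2 (append-↑ʳ w1 w2))) t2))

  ∃-piece : ∀ {n} → Piece (suc n) → Piece n
  ∃-piece p with Mentions? p zero
  ... | no np = Strengthen.piece p np
  ... | yes (j0 , e0) = ∃-mentioned p j0 e0

  ∃-piece-sem : ∀ {n} (p : Piece (suc n)) v → (Σ C λ x → PSat p (ext x v)) ↔ PSat (∃-piece p) v
  ∃-piece-sem p v with Mentions? p zero
  ... | no np = (λ { (x , s) → proj₁ (Strengthen.sem p np x v) s }) , (λ s → a₀ , proj₂ (Strengthen.sem p np a₀ v) s)
  ... | yes (j0 , e0) = ∃-mentioned-sem p j0 e0 v

  ∃^-piece : ∀ s {n} → Piece (s + n) → Piece n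
  ∃^-piece zero q = q
  ∃^-piece (suc s) q = ∃^-piece s (∃-piece q)

  ∃^-piece-sem : ∀ s {n} (q : Piece (s + n)) v → PSat (∃^-piece s q) v ↔ Σ (Fin s → C) λ w → PSat q (append w v)
  ∃^-piece-sem zero q v = (λ x → (λ ()) , x) , proj₂
  ∃^-piece-sem (suc s) q v = to , from
    where
      to : PSat (∃^-piece (suc s) q) v → Σ (Fin (suc s) → C) λ w → PSat q (append w v)
      to t = let (w' , t') = proj₁ (∃^-piece-sem s (∃-piece q) v) t
                 (x , t'') = proj₂ (∃-piece-sem q (append w' v)) t'
             in ext x w' , PSat-cong q (≗-sym (append-uncons (ext x w') v)) t''
      from : (Σ (Fin (suc s) → C) λ w → PSat q (append w v)) → PSat (∃^-piece (suc s) q) v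
      from (w , t) = proj₂ (∃^-piece-sem s (∃-piece q) v)
        ((λ i → w (suc i)) , proj₁ (∃-piece-sem q (append (λ i → w (suc i)) v)) (w zero , PSat-cong q (append-uncons w v) t))

-- Counting: for linked pieces, and relations built from them, the statement
-- "at least s values x satisfy F(x, v)" is a boolean combination of pieces
-- in v, uniformly in s.
module Counting (lem : LEM) (L : Language) (M : Structure L) (a₀ : Structure.Carrier M) where
  open Structure M renaming (Carrier to C)
  open Semantics L M
  open Conjunction lem L M a₀

  -- "At least s distinct x with p(x, v)" is a piece in v: conjoin s copies of
  -- p on fresh variables (linked through the parameter c), require the
  -- copies to be pairwise distinct, and quantify them away.
  module CopiesOf {n} (p : Piece (suc n)) (cn : Linked p) (s' : ℕ) where
    open Linked cn
    -- copy i of p uses the variable i for x and shares the parameters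
    s = suc s'
    S = s + n
    σ : Fin s → Fin (suc n) → Fin S
    σ i zero = i ↑ˡ n
    σ i (suc j) = s ↑ʳ j
    lr : ∀ {i : Fin s} {j : Fin n} → i ↑ˡ n ≢ s ↑ʳ j
    lr {i} {j} e = h (trans (sym (FP.splitAt-↑ˡ s i n)) (trans (cong (splitAt s) e) (FP.splitAt-↑ʳ s n j)))
      where h : ∀ {a : Fin s} {b : Fin n} → inj₁ a ≢ inj₂ b
            h ()
    σinj : ∀ i {a b} → σ i a ≡ σ i b → a ≡ b
    σinj i {zero} {zero} e = refl
    σinj i {zero} {suc b} e = ⊥-elim (lr e)
    σinj i {suc a} {zero} e = ⊥-elim (lr (sym e))
    σinj i {suc a} {suc b} e = cong suc (FP.↑ʳ-injective s a b e)
    copy : Fin s → Piece S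
    copy i = renamePiece (σ i) (σinj i) p

    -- the conjunction of the copies f 0, …, f l is a piece still mentioning
    -- the parameter c and each variable f i (so conjunctions keep sharing c)
    CopiesConj : ∀ {l} → (Fin (suc l) → Fin s) → Set
    CopiesConj {l} f = Σ (Piece S) λ q → Mentions q (s ↑ʳ c) × (∀ i → Mentions q (f i ↑ˡ n)) ×
                                         (∀ u → PSat q u ↔ (∀ i → PSat (copy (f i)) u))

    conjCopies : (l : ℕ) → (f : Fin (suc l) → Fin s) → CopiesConj f
    conjCopies zero f = copy (f zero) , (jc , cong (σ (f zero)) ec) , (λ { zero → j0 , cong (σ (f zero)) e0 }) ,
                   λ u → (λ t → λ { zero → t }) , (λ h → h zero)
    conjCopies (suc l) f = go (conjCopies l (λ i → f (suc i)))
      where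
        go : CopiesConj (λ i → f (suc i)) → CopiesConj f
        go (q , (jq , ejq) , xq , semq) = r , ConjPiece.mentions₂ p1 q shr (jq , ejq) , xr , semr
          where
            p1 = copy (f zero)
            shr : Shared p1 q
            shr = jc , jq , trans (cong (σ (f zero)) ec) (sym ejq)
            r = ConjPiece.piece p1 q shr
            xr : ∀ i → Mentions r (f i ↑ˡ n)
            xr zero = ConjPiece.mentions₁ p1 q shr (j0 , cong (σ (f zero)) e0)
            xr (suc i) = ConjPiece.mentions₂ p1 q shr (xq i)
            semr : ∀ u → PSat r u ↔ (∀ i → PSat (copy (f i)) u)
            semr u = (λ t → let (a , b) = proj₁ (ConjPiece.sem p1 q shr u) t in
                             λ { zero → a ; (suc i) → proj₁ (semq u) b i })
                   , (λ h → proj₂ (ConjPiece.sem p1 q shr u) (h zero , proj₂ (semq u) (λ i → h (suc i))))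

    DistinctAt : Asg S → Fin s × Fin s → Set
    DistinctAt u pr = proj₁ pr ≢ proj₂ pr → u (proj₁ pr ↑ˡ n) ≢ u (proj₂ pr ↑ˡ n)

    WithDistinct : Piece S → List (Fin s × Fin s) → Set
    WithDistinct q ps = Σ (Piece S) λ r → (∀ i → Mentions r (i ↑ˡ n)) × (∀ u → PSat r u ↔ (PSat q u × All (DistinctAt u) ps))

    addDistinct : (q : Piece S) → (∀ i → Mentions q (i ↑ˡ n)) → (ps : List (Fin s × Fin s)) → WithDistinct q ps
    addDistinct q xq [] = q , xq , λ u → (λ t → t , []) , proj₁
    addDistinct q xq ((a , b) ∷ ps) with a F.≟ b | addDistinct q xq ps
    ... | yes e | (r , xr , sr) = r , xr , λ u →
           (λ t → let (t1 , t2) = proj₁ (sr u) t in t1 , (λ ne → ⊥-elim (ne e)) ∷ t2)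
         , (λ { (t1 , _ ∷ t2) → proj₂ (sr u) (t1 , t2) })
    ... | no ne | (r , xr , sr) = distinctPiece r ja jb , xr , λ u →
           (λ t → let (t1 , t2) = proj₁ (distinctPiece-sem r ja jb u) t
                      (t3 , t4) = proj₁ (sr u) t1
                  in t3 , (λ _ e → t2 (trans (cong u ea) (trans e (cong u (sym eb))))) ∷ t4)
         , (λ { (t1 , d ∷ t2) → proj₂ (distinctPiece-sem r ja jb u)
                   (proj₂ (sr u) (t1 , t2) , λ e → d ne (trans (cong u (sym ea)) (trans e (cong u eb)))) })
      where
        ja = proj₁ (xr a)
        ea = proj₂ (xr a)
        jb = proj₁ (xr b)
        eb = proj₂ (xr b)

    pairs : List (Fin s × Fin s)
    pairs = List.cartesianProduct (List.allFin s) (List.allFin s)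

    pair∈ : ∀ i j → (i , j) ∈ pairs
    pair∈ i j = MP.∈-cartesianProduct⁺ (MP.∈-allFin i) (MP.∈-allFin j)

    allCopies = conjCopies s' (λ i → i)
    copiesPiece = proj₁ allCopies
    allDistinct = addDistinct copiesPiece (proj₁ (proj₂ (proj₂ allCopies))) pairs
    distinctCopiesPiece = proj₁ allDistinct
    countPiece : Piece n
    countPiece = ∃^-piece s distinctCopiesPiece

    copy-eq : ∀ (w : Fin s → C) v i → (λ a → append w v (σ i a)) ≗ ext (w i) v
    copy-eq w v i zero = append-↑ˡ w v i
    copy-eq w v i (suc j) = append-↑ʳ w v j

    countPiece-sem : ∀ v → AtLeast s (λ x → PSat p (ext x v)) ↔ PSat countPiece v
    countPiece-sem v = to , from
      where
        to : AtLeast s (λ x → PSat p (ext x v)) → PSat countPiece v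
        to (xs , dist , all) = proj₂ (∃^-piece-sem s distinctCopiesPiece v) (xs , proj₂ (proj₂ (proj₂ allDistinct) (append xs v))
           (proj₂ (proj₂ (proj₂ (proj₂ allCopies)) (append xs v)) (λ i → PSat-cong p (≗-sym (copy-eq xs v i)) (all i)) ,
            All.tabulate (λ { {(i , j)} _ ne e → ne (dist i j (trans (sym (append-↑ˡ xs v i)) (trans e (append-↑ˡ xs v j)))) })))
        from : PSat countPiece v → AtLeast s (λ x → PSat p (ext x v))
        from t = let (w , t1) = proj₁ (∃^-piece-sem s distinctCopiesPiece v) t
                     (t2 , ds) = proj₁ (proj₂ (proj₂ allDistinct) (append w v)) t1
                     t3 = proj₁ (proj₂ (proj₂ (proj₂ allCopies)) (append w v)) t2
                 in w , dist' w ds , λ i → PSat-cong p (copy-eq w v i) (t3 i)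
          where
            dist' : ∀ w → All (DistinctAt (append w v)) pairs → ∀ i j → w i ≡ w j → i ≡ j
            dist' w ds i j e with i F.≟ j
            ... | yes ij = ij
            ... | no ne = ⊥-elim (All.lookup ds (pair∈ i j) ne (trans (append-↑ˡ w v i) (trans e (sym (append-↑ˡ w v j)))))

  atLeastPiece : ∀ {n} (p : Piece (suc n)) → Linked p → ℕ → Piece n
  atLeastPiece p cn zero = ⊤-piece
  atLeastPiece p cn (suc s') = CopiesOf.countPiece p cn s'

  atLeastPiece-sem : ∀ {n} (p : Piece (suc n)) (cn : Linked p) s v → AtLeast s (λ x → PSat p (ext x v)) ↔ PSat (atLeastPiece p cn s) v
  atLeastPiece-sem p cn zero v = (λ _ → tt) , (λ _ → (λ ()) , (λ ()) , (λ ()))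
  atLeastPiece-sem p cn (suc s') v = CopiesOf.countPiece-sem p cn s' v

  Among : ∀ {N} → (Fin N → C) → C → Set
  Among {N} zs x = Σ (Fin N) λ i → zs i ≡ x

  partition : ∀ (B : C → Set) N (zs : Fin N → C) → (∀ i j → zs i ≡ zs j → i ≡ j) →
    Σ ℕ λ a → Σ ℕ λ b → (a + b ≡ N) × AtLeast a (λ x → ¬ B x × Among zs x) × AtLeast b (λ x → B x × Among zs x)
  partition B zero zs d = 0 , 0 , refl , ((λ ()) , (λ ()) , (λ ())) , ((λ ()) , (λ ()) , (λ ()))
  partition B (suc N) zs d with partition B N (λ i → zs (suc i)) (λ i j e → FP.suc-injective (d _ _ e)) | lem (B (zs zero))
  ... | a , b , e , ga , gb | inj₁ bz =
        a , suc b , trans (ℕP.+-suc a b) (cong suc e) ,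
        AtLeast-map {A = λ x → ¬ B x × Among (λ i → zs (suc i)) x} {B = λ x → ¬ B x × Among zs x}
          (λ { x (nb , (i , ei)) → nb , suc i , ei }) ga ,
        AtLeast-cons {A = λ x → B x × Among zs x} (zs zero) (bz , zero , refl)
          (AtLeast-map {A = λ x → B x × Among (λ i → zs (suc i)) x} {B = λ y → (B y × Among zs y) × y ≢ zs zero}
             (λ { x (bx , (i , ei)) → (bx , suc i , ei) , λ ex → zne i (trans ei ex) }) gb)
    where zne : ∀ i → zs (suc i) ≢ zs zero
          zne i ee with d _ _ ee
          ... | ()
  ... | a , b , e , ga , gb | inj₂ nbz =
        suc a , b , cong suc e ,
        AtLeast-cons {A = λ x → ¬ B x × Among zs x} (zs zero) (nbz , zero , refl)
          (AtLeast-map {A = λ x → ¬ B x × Among (λ i → zs (suc i)) x} {B = λ y → (¬ B y × Among zs y) × y ≢ zs zero}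
             (λ { x (nbx , (i , ei)) → (nbx , suc i , ei) , λ ex → zne i (trans ei ex) }) ga) ,
        AtLeast-map {A = λ x → B x × Among (λ i → zs (suc i)) x} {B = λ x → B x × Among zs x}
          (λ { x (bx , (i , ei)) → bx , suc i , ei }) gb
    where zne : ∀ i → zs (suc i) ≢ zs zero
          zne i ee with d _ _ ee
          ... | ()

  AtLeast-minus : ∀ s b {A B : C → Set} → AtLeast (s + b) A → ¬ AtLeast (suc b) B → AtLeast s (λ x → A x × ¬ B x)
  AtLeast-minus s b {A} {B} (zs , d , az) nb with partition B (s + b) zs d
  ... | a , b' , e , ga , gb with suc b ℕ.≤? b'
  ...   | yes le = ⊥-elim (nb (AtLeast-mono {A = B} le (AtLeast-map {A = λ x → B x × Among zs x} {B = B} (λ x → proj₁) gb)))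
  ...   | no nle = AtLeast-mono {A = λ x → A x × ¬ B x} s≤a
                       (AtLeast-map {A = λ x → ¬ B x × Among zs x} {B = λ x → A x × ¬ B x}
                          (λ { x (nbx , (i , ei)) → subst A ei (az i) , nbx }) ga)
    where
      b'≤b : b' ℕ.≤ b
      b'≤b = ℕP.≤-pred (ℕP.≰⇒> nle)
      s≤a : s ℕ.≤ a
      s≤a = ℕP.+-cancelʳ-≤ b s a (subst (ℕ._≤ a + b) e (ℕP.+-monoʳ-≤ a b'≤b))

  exact-count : ∀ K {A : C → Set} → ¬ AtLeast (suc K) A → Σ ℕ λ b → b ≤ K × AtLeast b A × ¬ AtLeast (suc b) A
  exact-count K {A} nk with lem (AtLeast K A)
  ... | inj₁ g = K , ℕP.≤-refl , g , nk
  exact-count zero {A} nk | inj₂ ng = ⊥-elim (ng ((λ ()) , (λ ()) , (λ ())))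
  exact-count (suc K) {A} nk | inj₂ ng = let (b , le , g , ng') = exact-count K {A} ng in b , ℕP.m≤n⇒m≤1+n le , g , ng'

  record Counted {n} (F : C → Asg n → Set) : Set where
    constructor mkCounted
    field
      K : ℕ
      bnd : ∀ v → ¬ AtLeast (suc K) (λ x → F x v)
      cnt : ∀ s → Definable λ v → AtLeast s (λ x → F x v)

  Counted-⇔ : ∀ {n} {F F' : C → Asg n → Set} → (∀ x v → F x v ↔ F' x v) → Counted F → Counted F'
  Counted-⇔ {F = F} {F'} h (mkCounted K bnd cnt) = mkCounted K
    (λ v g → bnd v (AtLeast-map {A = λ x → F' x v} {B = λ x → F x v} (λ x → proj₂ (h x v)) g))
    (λ s → proj₁ (cnt s) , λ v → (λ g → proj₁ (proj₂ (cnt s) v) (AtLeast-map {A = λ x → F' x v} {B = λ x → F x v} (λ x → proj₂ (h x v)) g))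
                              , (λ t → AtLeast-map {A = λ x → F x v} {B = λ x → F' x v} (λ x → proj₁ (h x v)) (proj₂ (proj₂ (cnt s) v) t)))

  -- Subtracting a counted G ⊆ F from a counted F: there are at least s x
  -- with F ∖ G iff for some b ≤ K_G there are exactly b x with G and at
  -- least s + b x with F.
  Counted-minus : ∀ {n} {F G : C → Asg n → Set} → (∀ x v → G x v → F x v) → Counted F → Counted G →
             Counted (λ x v → F x v × ¬ G x v)
  Counted-minus {n} {F} {G} sub (mkCounted KF bF cF) (mkCounted KG bG cG) = mkCounted KF
    (λ v g → bF v (AtLeast-map {A = λ x → F x v × ¬ G x v} {B = λ x → F x v} (λ x → proj₁) g))
    (λ s → bigOr KG (λ b → andE (andE (proj₁ (cG b)) (negE (proj₁ (cG (suc b))))) (proj₁ (cF (s + b)))) , sem s)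
    where
      sem : ∀ s v → AtLeast s (λ x → F x v × ¬ G x v) ↔
            BHolds (bigOr KG (λ b → andE (andE (proj₁ (cG b)) (negE (proj₁ (cG (suc b))))) (proj₁ (cF (s + b))))) v
      sem s v = to , from
        where
          to : _
          to g = let (b , le , gb , ngb) = exact-count KG {λ x → G x v} (bG v) in
                 proj₂ (bigOr-sem KG _ v) (b , le ,
                   (proj₁ (proj₂ (cG b) v) gb , (λ t → ngb (proj₂ (proj₂ (cG (suc b)) v) t))) ,
                   proj₁ (proj₂ (cF (s + b)) v)
                     (AtLeast-map {A = λ x → (F x v × ¬ G x v) ⊎ G x v} {B = λ x → F x v}
                        (λ { x (inj₁ a) → proj₁ a ; x (inj₂ gx) → sub x v gx })
                        (AtLeast-++ s b {A = λ x → F x v × ¬ G x v} {B = λ x → G x v} (λ x a gx → proj₂ a gx) g gb)))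
          from : _
          from t = let (b , le , ((t1 , t2) , t3)) = proj₁ (bigOr-sem KG _ v) t in
                   AtLeast-minus s b {λ x → F x v} {λ x → G x v} (proj₂ (proj₂ (cF (s + b)) v) t3)
                     (λ g → t2 (proj₁ (proj₂ (cG (suc b)) v) g))

  -- The base cases: linked pieces (by atLeastPiece), and predicates of x
  -- alone with a finite bound (each count is then ⊤ or ⊥).
  Counted-linked : ∀ {n} (p : Piece (suc n)) → Linked p → Counted (λ x v → PSat p (ext x v))
  Counted-linked p cn = mkCounted (proj₁ (Linked-bounded p cn)) (proj₂ (Linked-bounded p cn))
    (λ s → pieceB (atLeastPiece p cn s) , atLeastPiece-sem p cn s)

  Counted-constant : ∀ {n} N (S : C → Set) → ¬ AtLeast (suc N) S → Counted {n} (λ x v → S x)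
  Counted-constant {n} N S nb = mkCounted N (λ v → nb) h
    where
      h : ∀ s → Definable {n} λ v → AtLeast s S
      h s with lem (AtLeast s S)
      ... | inj₁ g = ⊤B , λ v → (λ _ → tt) , (λ _ → g)
      ... | inj₂ ng = ⊥B , λ v → (λ g → ng g) , (λ ())

module Elimination (lem : LEM) (L : Language) (M : Structure L) (a₀ : Structure.Carrier M) where
  open Structure M renaming (Carrier to C)
  open Semantics L M
  open Conjunction lem L M a₀
  open Counting lem L M a₀
  open Classical lem

  Lit : ℕ → Set
  Lit n = Bool × Piece n

  LSat : ∀ {n} → Lit n → Asg n → Set
  LSat (true , p) v = PSat p v
  LSat (false , p) v = ¬ PSat p v

  CSat : ∀ {n} → List (Lit n) → Asg n → Set
  CSat [] v = ⊤
  CSat (l ∷ c) v = LSat l v × CSat c v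

  DSat : ∀ {n} → List (List (Lit n)) → Asg n → Set
  DSat [] v = ⊥
  DSat (c ∷ ds) v = CSat c v ⊎ DSat ds v

  CSat-++ : ∀ {n} (c d : List (Lit n)) v → CSat (c ++ d) v ↔ (CSat c v × CSat d v)
  CSat-++ [] d v = (λ t → tt , t) , proj₂
  CSat-++ (l ∷ c) d v = (λ { (a , t) → let (b , e) = proj₁ (CSat-++ c d v) t in (a , b) , e })
                      , (λ { ((a , b) , e) → a , proj₂ (CSat-++ c d v) (b , e) })

  DSat-++ : ∀ {n} (xs ys : List (List (Lit n))) v → DSat (xs ++ ys) v ↔ (DSat xs v ⊎ DSat ys v)
  DSat-++ [] ys v = inj₂ , λ { (inj₂ t) → t }
  DSat-++ (c ∷ xs) ys v = (λ { (inj₁ t) → inj₁ (inj₁ t) ; (inj₂ t) → [ (λ u → inj₁ (inj₂ u)) , inj₂ ]′ (proj₁ (DSat-++ xs ys v) t) })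
                        , (λ { (inj₁ (inj₁ t)) → inj₁ t ; (inj₁ (inj₂ t)) → inj₂ (proj₂ (DSat-++ xs ys v) (inj₁ t))
                             ; (inj₂ t) → inj₂ (proj₂ (DSat-++ xs ys v) (inj₂ t)) })

  DSat-map : ∀ {n} (c : List (Lit n)) ys v → DSat (List.map (c ++_) ys) v ↔ (CSat c v × DSat ys v)
  DSat-map c [] v = (λ ()) , (λ ())
  DSat-map c (d ∷ ys) v = (λ { (inj₁ t) → let (a , b) = proj₁ (CSat-++ c d v) t in a , inj₁ b
                             ; (inj₂ t) → let (a , b) = proj₁ (DSat-map c ys v) t in a , inj₂ b })
                        , (λ { (a , inj₁ b) → inj₁ (proj₂ (CSat-++ c d v) (a , b))
                             ; (a , inj₂ b) → inj₂ (proj₂ (DSat-map c ys v) (a , b)) })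

  dnf-∧ : ∀ {n} → List (List (Lit n)) → List (List (Lit n)) → List (List (Lit n))
  dnf-∧ [] ys = []
  dnf-∧ (c ∷ xs) ys = List.map (c ++_) ys ++ dnf-∧ xs ys

  DSat-∧ : ∀ {n} xs (ys : List (List (Lit n))) v → DSat (dnf-∧ xs ys) v ↔ (DSat xs v × DSat ys v)
  DSat-∧ [] ys v = (λ ()) , (λ { (() , _) })
  DSat-∧ (c ∷ xs) ys v =
    (λ t → [ (λ u → let (a , b) = proj₁ (DSat-map c ys v) u in inj₁ a , b)
           , (λ u → let (a , b) = proj₁ (DSat-∧ xs ys v) u in inj₂ a , b) ]′ (proj₁ (DSat-++ _ _ v) t))
    , (λ { (inj₁ a , b) → proj₂ (DSat-++ _ _ v) (inj₁ (proj₂ (DSat-map c ys v) (a , b)))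
         ; (inj₂ a , b) → proj₂ (DSat-++ _ _ v) (inj₂ (proj₂ (DSat-∧ xs ys v) (a , b))) })

  atomPiece : ∀ {n m} (χ : Fm m) → InE L M χ → (ρ : Fin m → Fin n) → Injective _≡_ _≡_ ρ → Piece n
  atomPiece χ (k , θ , qf , ma , e) ρ inj = mkPiece _ ρ inj k θ qf ma

  atomPiece-sem : ∀ {n m} (χ : Fm m) (e : InE L M χ) (ρ : Fin m → Fin n) (inj : Injective _≡_ _≡_ ρ) v →
                  PSat (atomPiece χ e ρ inj) v ↔ BHolds (atomE χ e ρ inj) v
  atomPiece-sem χ (k , θ , qf , ma , refl) ρ inj v = (λ t → t) , (λ t → t)

  dnfP dnfN : ∀ {n} → BE n → List (List (Lit n))
  dnfP (atomE χ e ρ inj) = ((true , atomPiece χ e ρ inj) ∷ []) ∷ []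
  dnfP (negE b) = dnfN b
  dnfP (andE b c) = dnf-∧ (dnfP b) (dnfP c)
  dnfP (orE b c) = dnfP b ++ dnfP c
  dnfN (atomE χ e ρ inj) = ((false , atomPiece χ e ρ inj) ∷ []) ∷ []
  dnfN (negE b) = dnfP b
  dnfN (andE b c) = dnfN b ++ dnfN c
  dnfN (orE b c) = dnf-∧ (dnfN b) (dnfN c)

  dnfP-sem : ∀ {n} (b : BE n) v → DSat (dnfP b) v ↔ BHolds b v
  dnfN-sem : ∀ {n} (b : BE n) v → DSat (dnfN b) v ↔ (¬ BHolds b v)
  dnfP-sem (atomE χ e ρ inj) v = (λ { (inj₁ (t , _)) → proj₁ (atomPiece-sem χ e ρ inj v) t })
                               , (λ t → inj₁ (proj₂ (atomPiece-sem χ e ρ inj v) t , tt))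
  dnfP-sem (negE b) v = dnfN-sem b v
  dnfP-sem (andE b c) v = (λ t → let (x , y) = proj₁ (DSat-∧ _ _ v) t in proj₁ (dnfP-sem b v) x , proj₁ (dnfP-sem c v) y)
                        , (λ { (x , y) → proj₂ (DSat-∧ _ _ v) (proj₂ (dnfP-sem b v) x , proj₂ (dnfP-sem c v) y) })
  dnfP-sem (orE b c) v = (λ t → [ (λ x → inj₁ (proj₁ (dnfP-sem b v) x)) , (λ y → inj₂ (proj₁ (dnfP-sem c v) y)) ]′ (proj₁ (DSat-++ _ _ v) t))
                       , (λ { (inj₁ x) → proj₂ (DSat-++ _ _ v) (inj₁ (proj₂ (dnfP-sem b v) x))
                            ; (inj₂ y) → proj₂ (DSat-++ _ _ v) (inj₂ (proj₂ (dnfP-sem c v) y)) })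
  dnfN-sem (atomE χ e ρ inj) v = (λ { (inj₁ (t , _)) s → t (proj₂ (atomPiece-sem χ e ρ inj v) s) })
                               , (λ t → inj₁ ((λ s → t (proj₁ (atomPiece-sem χ e ρ inj v) s)) , tt))
  dnfN-sem (negE b) v = (λ t nb → nb (proj₁ (dnfP-sem b v) t)) , (λ nn → proj₂ (dnfP-sem b v) (dne nn))
  dnfN-sem (andE b c) v =
    (λ t → [ (λ x → λ { (sb , _) → proj₁ (dnfN-sem b v) x sb }) , (λ y → λ { (_ , sc) → proj₁ (dnfN-sem c v) y sc }) ]′ (proj₁ (DSat-++ _ _ v) t))
    , (λ nbc → proj₂ (DSat-++ _ _ v) (h nbc (lem (BHolds b v))))
    where
      h : ¬ (BHolds b v × BHolds c v) → BHolds b v ⊎ ¬ BHolds b v → DSat (dnfN b) v ⊎ DSat (dnfN c) v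
      h nbc (inj₁ sb) = inj₂ (proj₂ (dnfN-sem c v) (λ sc → nbc (sb , sc)))
      h nbc (inj₂ nb) = inj₁ (proj₂ (dnfN-sem b v) nb)
  dnfN-sem (orE b c) v = (λ t → let (x , y) = proj₁ (DSat-∧ _ _ v) t in
                                  λ { (inj₁ sb) → proj₁ (dnfN-sem b v) x sb ; (inj₂ sc) → proj₁ (dnfN-sem c v) y sc })
                       , (λ nbc → proj₂ (DSat-∧ _ _ v) (proj₂ (dnfN-sem b v) (λ sb → nbc (inj₁ sb)) , proj₂ (dnfN-sem c v) (λ sc → nbc (inj₂ sc))))

  litB : ∀ {n} → Lit n → BE n
  litB (true , p) = pieceB p
  litB (false , p) = negE (pieceB p)

  clauseB : ∀ {n} → List (Lit n) → BE n
  clauseB [] = ⊤B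
  clauseB (l ∷ c) = andE (litB l) (clauseB c)

  litB-sem : ∀ {n} (l : Lit n) v → LSat l v ↔ BHolds (litB l) v
  litB-sem (true , p) v = (λ t → t) , (λ t → t)
  litB-sem (false , p) v = (λ t → t) , (λ t → t)

  clauseB-sem : ∀ {n} (c : List (Lit n)) v → CSat c v ↔ BHolds (clauseB c) v
  clauseB-sem [] v = (λ _ → tt) , (λ _ → tt)
  clauseB-sem (l ∷ c) v = (λ { (a , b) → proj₁ (litB-sem l v) a , proj₁ (clauseB-sem c v) b })
                        , (λ { (a , b) → proj₂ (litB-sem l v) a , proj₂ (clauseB-sem c v) b })

  ZeroPiece : ℕ → Set
  ZeroPiece n = Σ (Piece (suc n)) λ p → Mentions p zero

  LinkedZeroPiece : ℕ → Set
  LinkedZeroPiece n = Σ (ZeroPiece n) λ z → Σ (Fin n) λ c → Mentions (proj₁ z) (suc c)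

  AllHold : ∀ {n} → List (ZeroPiece n) → C → Asg n → Set
  AllHold [] x v = ⊤
  AllHold (z ∷ zs) x v = PSat (proj₁ z) (ext x v) × AllHold zs x v

  NoneHold : ∀ {n} → List (ZeroPiece n) → C → Asg n → Set
  NoneHold [] x v = ⊤
  NoneHold (z ∷ zs) x v = ¬ PSat (proj₁ z) (ext x v) × NoneHold zs x v

  NoneHold-++ : ∀ {n} (xs ys : List (ZeroPiece n)) x v → NoneHold (xs ++ ys) x v ↔ (NoneHold xs x v × NoneHold ys x v)
  NoneHold-++ [] ys x v = (λ t → tt , t) , proj₂
  NoneHold-++ (z ∷ xs) ys x v = (λ { (a , t) → let (b , e) = proj₁ (NoneHold-++ xs ys x v) t in (a , b) , e })
                          , (λ { ((a , b) , e) → a , proj₂ (NoneHold-++ xs ys x v) (b , e) })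

  zero-shared : ∀ {n} (z w : ZeroPiece n) → Shared (proj₁ z) (proj₁ w)
  zero-shared z w = proj₁ (proj₂ z) , proj₁ (proj₂ w) , trans (proj₂ (proj₂ z)) (sym (proj₂ (proj₂ w)))

  conjZero : ∀ {n} → ZeroPiece n → ZeroPiece n → ZeroPiece n
  conjZero z w = ConjPiece.piece (proj₁ z) (proj₁ w) (zero-shared z w) , ConjPiece.mentions₁ (proj₁ z) (proj₁ w) (zero-shared z w) (proj₂ z)

  conjZero-sem : ∀ {n} (z w : ZeroPiece n) u → PSat (proj₁ (conjZero z w)) u ↔ (PSat (proj₁ z) u × PSat (proj₁ w) u)
  conjZero-sem z w u = ConjPiece.sem (proj₁ z) (proj₁ w) (zero-shared z w) u

  conjZero-mentions : ∀ {n} (z w : ZeroPiece n) {y} → Mentions (proj₁ z) y → Mentions (proj₁ (conjZero z w)) y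
  conjZero-mentions z w = ConjPiece.mentions₁ (proj₁ z) (proj₁ w) (zero-shared z w)

  conjAll : ∀ {n} → ZeroPiece n → List (ZeroPiece n) → ZeroPiece n
  conjAll z [] = z
  conjAll z (w ∷ ws) = conjAll (conjZero z w) ws

  conjAll-sem : ∀ {n} (z : ZeroPiece n) ws x v → PSat (proj₁ (conjAll z ws)) (ext x v) ↔ (PSat (proj₁ z) (ext x v) × AllHold ws x v)
  conjAll-sem z [] x v = (λ t → t , tt) , proj₁
  conjAll-sem z (w ∷ ws) x v =
    (λ t → let (a , b) = proj₁ (conjAll-sem (conjZero z w) ws x v) t
               (c , d) = proj₁ (conjZero-sem z w (ext x v)) a
           in c , d , b)
    , (λ { (c , d , b) → proj₂ (conjAll-sem (conjZero z w) ws x v) (proj₂ (conjZero-sem z w (ext x v)) (c , d) , b) })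

  conjAll-mentions : ∀ {n} (z : ZeroPiece n) ws {y} → Mentions (proj₁ z) y → Mentions (proj₁ (conjAll z ws)) y
  conjAll-mentions z [] s = s
  conjAll-mentions z (w ∷ ws) s = conjAll-mentions (conjZero z w) ws (conjZero-mentions z w s)

  linked-or-zeroOnly : ∀ {n} (p : Piece (suc n)) → (Σ (Fin n) λ c → Mentions p (suc c)) ⊎ (∀ j → place p j ≡ zero)
  linked-or-zeroOnly p with FP.any? (λ j → ¬? (place p j F.≟ zero))
  ... | yes (j , ne) = inj₁ (h j ne)
    where
      h : ∀ j → place p j ≢ zero → Σ _ λ c → Mentions p (suc c)
      h j ne with place p j in eq
      ... | zero = ⊥-elim (ne refl)
      ... | suc c = c , j , eq
  ... | no nz = inj₂ λ j → dne (λ ne → nz (j , ne))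

  linkedAtZero : ∀ {n} (z : ZeroPiece n) → (Σ (Fin n) λ c → Mentions (proj₁ z) (suc c)) → Linked (proj₁ z)
  linkedAtZero z (c , jc , ec) = mkLinked (proj₁ (proj₂ z)) (proj₂ (proj₂ z)) c jc ec

  zeroOnly-independent : ∀ {n} (p : Piece (suc n)) → (∀ j → place p j ≡ zero) → ∀ x v v' → PSat p (ext x v) → PSat p (ext x v')
  zeroOnly-independent p h x v v' = Sat-cong (∃^ L (nbound p) (matrix p)) (λ j → trans (cong (ext x v) (h j)) (sym (cong (ext x v') (h j))))

  AtLeast-one : ∀ {A : C → Set} → AtLeast 1 A ↔ Σ C A
  AtLeast-one = (λ { (xs , _ , a) → xs zero , a zero })
      , (λ { (x , a) → (λ _ → x) , (λ { zero zero _ → refl }) , (λ { zero → a }) })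

  -- A linked piece P with finitely many negated pieces is counted, by
  -- induction on the negated pieces: P ∧ ¬N ∧ R is (P ∧ R) minus
  -- ((P ∧ N) ∧ R), and P ∧ N is again linked.
  Counted-piece-minus : ∀ {n} (P : Piece (suc n)) → Linked P → (neg : List (ZeroPiece n)) → Counted (λ x v → PSat P (ext x v) × NoneHold neg x v)
  Counted-piece-minus P cn [] = Counted-⇔ (λ x v → (λ t → t , tt) , proj₁) (Counted-linked P cn)
  Counted-piece-minus {n} P cn (l ∷ Ls) = Counted-⇔ e (Counted-minus sub (Counted-piece-minus P cn Ls) (Counted-piece-minus P' cn' Ls))
    where
      open Linked cn
      z : ZeroPiece n
      z = P , j0 , e0
      P' = proj₁ (conjZero z l)
      cn' : Linked P'
      cn' = linkedAtZero (conjZero z l) (c , conjZero-mentions z l (jc , ec))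
      sub : ∀ x v → PSat P' (ext x v) × NoneHold Ls x v → PSat P (ext x v) × NoneHold Ls x v
      sub x v (t , a) = proj₁ (proj₁ (conjZero-sem z l (ext x v)) t) , a
      e : ∀ x v → ((PSat P (ext x v) × NoneHold Ls x v) × ¬ (PSat P' (ext x v) × NoneHold Ls x v)) ↔
                  (PSat P (ext x v) × NoneHold (l ∷ Ls) x v)
      e x v = (λ { ((p , a) , ng) → p , (λ pl → ng (proj₂ (conjZero-sem z l (ext x v)) (p , pl) , a)) , a })
            , (λ { (p , nl , a) → (p , a) , λ { (t , _) → nl (proj₂ (proj₁ (conjZero-sem z l (ext x v)) t)) } })

  -- A clause whose positive part mentions only x: the set S of its
  -- solutions among the zero-only literals is independent of the parameters.
  -- If S is finite, counting applies; if S is infinite, the remaining linked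
  -- negative pieces exclude only boundedly many x, so a solution exists.
  module ZeroOnly {n} (pos Qs : List (ZeroPiece n)) (S : C → Set)
              (hS : ∀ x v → S x ↔ (AllHold pos x v × NoneHold Qs x v)) where

    Ls : List (LinkedZeroPiece n) → List (ZeroPiece n)
    Ls = List.map proj₁

    module Bounded (N : ℕ) (nb : ¬ AtLeast (suc N) S) where
      counted : (Lc : List (LinkedZeroPiece n)) → Counted (λ x v → S x × NoneHold (Ls Lc) x v)
      counted [] = Counted-⇔ (λ x v → (λ s → s , tt) , proj₁) (Counted-constant N S nb)
      counted ((β , mk) ∷ Lc) = Counted-⇔ e (Counted-minus (λ x v → proj₁) (counted Lc) G')
        where
          L' = Ls Lc
          Pβ = conjAll β pos
          cnβ = linkedAtZero Pβ (proj₁ mk , conjAll-mentions β pos (proj₂ mk))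
          e2 : ∀ x v → (PSat (proj₁ Pβ) (ext x v) × NoneHold (Qs ++ L') x v) ↔ ((S x × NoneHold L' x v) × PSat (proj₁ β) (ext x v))
          e2 x v = (λ { (t , a) → let (pb , ap) = proj₁ (conjAll-sem β pos x v) t
                                      (aq , al) = proj₁ (NoneHold-++ Qs L' x v) a
                                  in (proj₂ (hS x v) (ap , aq) , al) , pb })
                 , (λ { ((s , al) , pb) → let (ap , aq) = proj₁ (hS x v) s in
                         proj₂ (conjAll-sem β pos x v) (pb , ap) , proj₂ (NoneHold-++ Qs L' x v) (aq , al) })
          G' = Counted-⇔ e2 (Counted-piece-minus (proj₁ Pβ) cnβ (Qs ++ L'))
          e : ∀ x v → ((S x × NoneHold L' x v) × ¬ ((S x × NoneHold L' x v) × PSat (proj₁ β) (ext x v))) ↔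
                      (S x × NoneHold (Ls ((β , mk) ∷ Lc)) x v)
          e x v = (λ { ((s , a) , ng) → s , (λ pb → ng ((s , a) , pb)) , a })
                , (λ { (s , nbb , a) → (s , a) , λ g → nbb (proj₂ g) })

    -- S infinite: each linked negative excludes at most its bound many x
    totalBound : List (LinkedZeroPiece n) → ℕ
    totalBound [] = 0
    totalBound ((β , mk) ∷ Lc) = proj₁ (Linked-bounded (proj₁ β) (linkedAtZero β mk)) + totalBound Lc

    avoid : (Lc : List (LinkedZeroPiece n)) → ∀ v s → AtLeast (s + totalBound Lc) S → AtLeast s (λ x → S x × NoneHold (Ls Lc) x v)
    avoid [] v s g = AtLeast-map {A = S} {B = λ x → S x × ⊤} (λ x t → t , tt) (subst (λ z → AtLeast z S) (ℕP.+-identityʳ s) g)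
    avoid ((β , mk) ∷ Lc) v s g =
      AtLeast-map {A = λ x → (S x × NoneHold (Ls Lc) x v) × ¬ PSat (proj₁ β) (ext x v)}
             {B = λ x → S x × NoneHold (Ls ((β , mk) ∷ Lc)) x v}
             (λ { x ((s , a) , nb) → s , nb , a })
        (AtLeast-minus s Kβ {λ x → S x × NoneHold (Ls Lc) x v} {λ x → PSat (proj₁ β) (ext x v)}
           (avoid Lc v (s + Kβ) (subst (λ z → AtLeast z S) (sym (ℕP.+-assoc s Kβ (totalBound Lc))) g))
           (proj₂ (Linked-bounded (proj₁ β) (linkedAtZero β mk)) v))
      where Kβ = proj₁ (Linked-bounded (proj₁ β) (linkedAtZero β mk))

    ∃-solution : (Lc : List (LinkedZeroPiece n)) → Definable λ v → Σ C λ x → S x × NoneHold (Ls Lc) x v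
    ∃-solution Lc with lem (Σ ℕ λ N → ¬ AtLeast N S)
    ... | inj₁ (N , ng) =
          let cn = Bounded.counted N (λ g → ng (AtLeast-mono {A = S} (ℕP.n≤1+n N) g)) Lc
              (b , sb) = Counted.cnt cn 1
          in b , λ v → (λ t → proj₁ (sb v) (proj₂ AtLeast-one t)) , (λ t → proj₁ AtLeast-one (proj₂ (sb v) t))
    ... | inj₂ nn = ⊤B , λ v → (λ _ → tt) ,
          (λ _ → proj₁ (AtLeast-one {λ x → S x × NoneHold (Ls Lc) x v}) (avoid Lc v 1 (dne (λ ng → nn (_ , ng)))))

  splitNegatives : ∀ {n} (neg : List (ZeroPiece n)) → Σ (List (ZeroPiece n)) λ Qs → Σ (List (LinkedZeroPiece n)) λ Lc →
             (∀ x v → NoneHold neg x v ↔ (NoneHold Qs x v × NoneHold (List.map proj₁ Lc) x v)) ×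
             (∀ x v v' → NoneHold Qs x v → NoneHold Qs x v')
  splitNegatives [] = [] , [] , (λ x v → (λ _ → tt , tt) , (λ _ → tt)) , (λ _ _ _ _ → tt)
  splitNegatives (z ∷ neg) with linked-or-zeroOnly (proj₁ z) | splitNegatives neg
  ... | inj₁ mk | (Qs , Lc , e , ind) = Qs , (z , mk) ∷ Lc ,
          (λ x v → (λ { (nz , a) → let (q , l) = proj₁ (e x v) a in q , nz , l })
                 , (λ { (q , nz , l) → nz , proj₂ (e x v) (q , l) })) , ind
  ... | inj₂ pure | (Qs , Lc , e , ind) = z ∷ Qs , Lc ,
          (λ x v → (λ { (nz , a) → let (q , l) = proj₁ (e x v) a in (nz , q) , l })
                 , (λ { ((nz , q) , l) → nz , proj₂ (e x v) (q , l) })) ,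
          (λ x v v' → λ { (nz , q) → (λ t → nz (zeroOnly-independent (proj₁ z) pure x v' v t)) , ind x v v' q })

  -- ∃x (⋀ pos ∧ ⋀ ¬neg) is definable: if the conjunction of pos is linked
  -- we count, otherwise we are in the ZeroOnly situation (with the
  -- parameters of the independent part fixed to v₀).
  v₀ : ∀ {n} → Asg n
  v₀ _ = a₀

  ∃ConjT : ∀ {n} → List (ZeroPiece n) → List (ZeroPiece n) → Set
  ∃ConjT {n} pos neg = Definable λ v → Σ C λ x → AllHold pos x v × NoneHold neg x v

  zeroOnlyCase : ∀ {n} (pos neg : List (ZeroPiece n)) → (∀ x v v' → AllHold pos x v → AllHold pos x v') → ∃ConjT pos neg
  zeroOnlyCase {n} pos neg ind with splitNegatives neg
  ... | (Qs , Lc , e , indQ) = proj₁ r , λ v → (λ t → proj₁ (proj₂ r v) (to v t)) , (λ t → from v (proj₂ (proj₂ r v) t))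
    where
      S : C → Set
      S x = AllHold pos x v₀ × NoneHold Qs x v₀
      hS : ∀ x v → S x ↔ (AllHold pos x v × NoneHold Qs x v)
      hS x v = (λ { (a , q) → ind x v₀ v a , indQ x v₀ v q }) , (λ { (a , q) → ind x v v₀ a , indQ x v v₀ q })
      r = ZeroOnly.∃-solution pos Qs S hS Lc
      to : ∀ v → (Σ C λ x → AllHold pos x v × NoneHold neg x v) → Σ C λ x → S x × NoneHold (List.map proj₁ Lc) x v
      to v (x , a , ng) = let (q , l) = proj₁ (e x v) ng in x , proj₂ (hS x v) (a , q) , l
      from : ∀ v → (Σ C λ x → S x × NoneHold (List.map proj₁ Lc) x v) → Σ C λ x → AllHold pos x v × NoneHold neg x v
      from v (x , s , l) = let (a , q) = proj₁ (hS x v) s in x , a , proj₂ (e x v) (q , l)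

  ∃-conj : ∀ {n} (pos neg : List (ZeroPiece n)) → ∃ConjT pos neg
  ∃-conj [] neg = zeroOnlyCase [] neg (λ _ _ _ _ → tt)
  ∃-conj (z ∷ zs) neg with linked-or-zeroOnly (proj₁ (conjAll z zs))
  ... | inj₂ pure = zeroOnlyCase (z ∷ zs) neg
          (λ x v v' a → proj₁ (conjAll-sem z zs x v') (zeroOnly-independent (proj₁ (conjAll z zs)) pure x v v' (proj₂ (conjAll-sem z zs x v) a)))
  ... | inj₁ mk = b , λ v →
          (λ { (x , a , ng) → proj₁ (sb v) (proj₂ (AtLeast-one {λ x → PSat P (ext x v) × NoneHold neg x v}) (x , proj₂ (conjAll-sem z zs x v) a , ng)) })
        , (λ t → let (x , (p , ng)) = proj₁ (AtLeast-one {λ x → PSat P (ext x v) × NoneHold neg x v}) (proj₂ (sb v) t)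
                 in x , proj₁ (conjAll-sem z zs x v) p , ng)
    where
      P = proj₁ (conjAll z zs)
      cnt = Counted-piece-minus P (linkedAtZero (conjAll z zs) mk) neg
      b = proj₁ (Counted.cnt cnt 1)
      sb = proj₂ (Counted.cnt cnt 1)

  SplitT : ∀ {n} → List (Lit (suc n)) → Set
  SplitT {n} cl = Σ (List (Lit n)) λ out → Σ (List (ZeroPiece n)) λ pos → Σ (List (ZeroPiece n)) λ neg →
                  ∀ x v → CSat cl (ext x v) ↔ (CSat out v × AllHold pos x v × NoneHold neg x v)

  splitClause : ∀ {n} (cl : List (Lit (suc n))) → SplitT cl
  splitClause [] = [] , [] , [] , λ x v → (λ _ → tt , tt , tt) , (λ _ → tt)
  splitClause ((b , p) ∷ cl) with Mentions? p zero | splitClause cl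
  ... | no np | (out , pos , neg , e) = (b , Strengthen.piece p np) ∷ out , pos , neg ,
         λ x v → (λ { (l , t) → let (o , a , g) = proj₁ (e x v) t in (lit→ b x v l , o) , a , g })
               , (λ { ((l , o) , a , g) → lit← b x v l , proj₂ (e x v) (o , a , g) })
    where
      lit→ : ∀ b x v → LSat (b , p) (ext x v) → LSat (b , Strengthen.piece p np) v
      lit→ true x v l = proj₁ (Strengthen.sem p np x v) l
      lit→ false x v l t = l (proj₂ (Strengthen.sem p np x v) t)
      lit← : ∀ b x v → LSat (b , Strengthen.piece p np) v → LSat (b , p) (ext x v)
      lit← true x v l = proj₂ (Strengthen.sem p np x v) l
      lit← false x v l t = l (proj₁ (Strengthen.sem p np x v) t)
  ... | yes zp | (out , pos , neg , e) with b
  ...   | true = out , (p , zp) ∷ pos , neg ,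
           λ x v → (λ { (l , t) → let (o , a , g) = proj₁ (e x v) t in o , (l , a) , g })
                 , (λ { (o , (l , a) , g) → l , proj₂ (e x v) (o , a , g) })
  ...   | false = out , pos , (p , zp) ∷ neg ,
           λ x v → (λ { (l , t) → let (o , a , g) = proj₁ (e x v) t in o , a , (l , g) })
                 , (λ { (o , a , (l , g)) → l , proj₂ (e x v) (o , a , g) })

  ∃-clause : ∀ {n} (cl : List (Lit (suc n))) → Definable λ v → Σ C λ x → CSat cl (ext x v)
  ∃-clause cl with splitClause cl
  ... | (out , pos , neg , e) = andE (clauseB out) (proj₁ (∃-conj pos neg)) , λ v →
        (λ { (x , t) → let (o , a , g) = proj₁ (e x v) t in
               proj₁ (clauseB-sem out v) o , proj₁ (proj₂ (∃-conj pos neg) v) (x , a , g) })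
      , (λ { (o , k) → let (x , a , g) = proj₂ (proj₂ (∃-conj pos neg) v) k in
               x , proj₂ (e x v) (proj₂ (clauseB-sem out v) o , a , g) })

  ∃-dnf : ∀ {n} (ds : List (List (Lit (suc n)))) → Definable λ v → Σ C λ x → DSat ds (ext x v)
  ∃-dnf [] = ⊥B , λ v → (λ { (_ , ()) }) , (λ ())
  ∃-dnf (c ∷ ds) = orE (proj₁ (∃-clause c)) (proj₁ (∃-dnf ds)) , λ v →
      (λ { (x , inj₁ t) → inj₁ (proj₁ (proj₂ (∃-clause c) v) (x , t))
         ; (x , inj₂ t) → inj₂ (proj₁ (proj₂ (∃-dnf ds) v) (x , t)) })
    , (λ { (inj₁ t) → let (x , u) = proj₂ (proj₂ (∃-clause c) v) t in x , inj₁ u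
         ; (inj₂ t) → let (x , u) = proj₂ (proj₂ (∃-dnf ds) v) t in x , inj₂ u })

  ∃-bool : ∀ {n} (b : BE (suc n)) → Definable λ v → Σ C λ x → BHolds b (ext x v)
  ∃-bool b = proj₁ (∃-dnf (dnfP b)) , λ v →
      (λ { (x , t) → proj₁ (proj₂ (∃-dnf (dnfP b)) v) (x , proj₂ (dnfP-sem b (ext x v)) t) })
    , (λ t → let (x , u) = proj₂ (proj₂ (∃-dnf (dnfP b)) v) t in x , proj₁ (dnfP-sem b (ext x v)) u)

module Translation (lem : LEM) (L : Language) (M : Structure L) (a₀ : Structure.Carrier M)
                   (mapr : MAPresented L M) where
  open Semantics L M
  open Elimination lem L M a₀
  open Classical lem

  -- An atomic formula is in 𝓔 by the MA-presentation once the variables it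
  -- does not mention are dropped and re-added as dummy variables.
  translate-atomic : ∀ n (φ : Fm n) → Atomic L φ → Definable (Holds φ)
  translate-atomic n φ at with FP.all? (λ i → Occurs? i φ at)
  ... | yes all = pieceB (mkPiece n (λ i → i) (λ e → e) 0 φ (atomic⇒QF at) (mapr φ at all)) , λ v → (λ t → t) , (λ t → t)
  translate-atomic zero φ at | no nall = ⊥-elim (nall (λ ()))
  translate-atomic (suc n) φ at | no nall =
    let (i , ni) = dne {Σ (Fin (suc n)) λ i → ¬ Occurs L i φ} (λ h → nall (λ i → dne (λ nn → h (i , nn))))
        (φ' , at' , e) = dropVar i φ at ni
        (b' , e') = translate-atomic n φ' at'
    in renameB (punchIn i) (λ {a} {b} → FP.punchIn-injective i a b) b' ,
       λ v → (λ t → proj₂ (renameB-sem (punchIn i) _ b' v) (proj₁ (e' _) (proj₂ (e v) t)))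
           , (λ t → proj₁ (e v) (proj₂ (e' _) (proj₁ (renameB-sem (punchIn i) _ b' v) t)))

  translate : ∀ {n} (φ : Fm n) → Definable (Holds φ)
  translate ⊤' = ⊤B , λ v → (λ t → t) , (λ t → t)
  translate ⊥' = ⊥B , λ v → (λ t → t) , (λ t → t)
  translate (s ≐ t) = translate-atomic _ _ (eq-atomic s t)
  translate (rel R ts) = translate-atomic _ _ (rel-atomic R ts)
  translate (¬' φ) = let (b , e) = translate φ in negE b , λ v → (λ t u → t (proj₂ (e v) u)) , (λ t u → t (proj₁ (e v) u))
  translate (φ ∧' ψ) = let (b , e) = translate φ ; (c , f) = translate ψ in andE b c , λ v →
                  (λ { (x , y) → proj₁ (e v) x , proj₁ (f v) y }) , (λ { (x , y) → proj₂ (e v) x , proj₂ (f v) y })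
  translate (φ ∨' ψ) = let (b , e) = translate φ ; (c , f) = translate ψ in orE b c , λ v →
                  (λ { (inj₁ x) → inj₁ (proj₁ (e v) x) ; (inj₂ y) → inj₂ (proj₁ (f v) y) })
                , (λ { (inj₁ x) → inj₁ (proj₂ (e v) x) ; (inj₂ y) → inj₂ (proj₂ (f v) y) })
  translate (∃' φ) = let (b , e) = translate φ ; (b' , e') = ∃-bool b in b' , λ v →
                (λ { (a , t) → proj₁ (e' v) (a , proj₁ (e (ext a v)) t) })
              , (λ t → let (a , u) = proj₂ (e' v) t in a , proj₂ (e (ext a v)) u)
  translate (∀' φ) = let (b , e) = translate φ ; (b' , e') = ∃-bool (negE b) in negE b' , λ v →
                (λ t u → let (a , nu) = proj₂ (e' v) u in nu (proj₁ (e (ext a v)) (t a)))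
              , (λ t a → proj₂ (e (ext a v)) (dne (λ nb → t (proj₁ (e' v) (a , nb)))))

proposition1 : LEM → (L : Language) (M : Structure L) → Infinite L M → MAPresented L M →
    ∀ {n : ℕ} (φ : Formula L n) → InE* L M φ
proposition1 lem L M inf mapr φ =
  let (b , e) = Translation.translate lem L M (infinite-inhabited lem L M inf) mapr φ in
  b , λ v → mk⇔ (proj₁ (e v)) (proj₂ (e v))
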